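{- Let $k>1$, let $U=(U_1\mid U_2)\in\mathbb{F}_q^{k\times(2k+1)}$ be a full-rank matrix with $U_1\in\mathbb{F}_q^{k\times k}$ and $U_2\in\mathbb{F}_q^{k\times(k+1)}$, and let $\mathcal{U}=\mathrm{rowsp}(U)$. Then the orbit code $\mathrm{Orb}_{\mathbf{G}}(\mathcal{U})$ is a partial spread of dimension $k$ of $\mathbb{F}_q^{2k+1}$ if and only if $\mathrm{rk}(U_1)=\mathrm{rk}(U_2)=k$. In that case $|\mathrm{Orb}_{\mathbf{G}}(\mathcal{U})|=|\mathbf{G}|=q^{k+1}-1$.
   Context: Let $M_{k+1}\in\mathrm{GL}(k+1,q)$ be the companion matrix of a primitive polynomial of degree $k+1$ over $\mathbb{F}_q$, let $g=\begin{pmatrix}I_k&0\\0&M_{k+1}\end{pmatrix}\in\mathrm{GL}(2k+1,q)$ and $\mathbf{G}=\langle g\rangle$, a cyclic group of order $q^{k+1}-1$. $\mathrm{GL}(2k+1,q)$ acts on subspaces by $\mathcal{V}\cdot A=\mathrm{rowsp}(VA)$ for $\mathcal{V}=\mathrm{rowsp}(V)$, and $\mathrm{Orb}_{\mathbf{G}}(\mathcal{V})=\{\mathcal{V}\cdot A\mid A\in\mathbf{G}\}$. A partial spread of dimension $k$ is a set of $k$-dimensional subspaces with subspace distance $d_S(\mathcal{A},\mathcal{B})=\dim(\mathcal{A}+\mathcal{B})-\dim(\mathcal{A}\cap\mathcal{B})$ between distinct members equal to $2k$ and minimum distance $2k$, i.e., it has at least two members and distinct members intersect trivially. -}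

module Defs where

open import Level using (Level; _⊔_) renaming (suc to lsuc)
open import Algebra.Bundles using (CommutativeRing)
open import Data.Nat using (ℕ; zero; suc)
open import Data.Fin using (Fin; toℕ; splitAt)
import Data.Fin
import Data.Nat as ℕ
open import Data.Sum using (_⊎_; inj₁; inj₂)
open import Data.Product using (Σ; ∃; _×_; _,_)
open import Data.Bool using (if_then_else_)
open import Relation.Nullary using (¬_)
open import Relation.Nullary.Decidable using (⌊_⌋)
open import Relation.Binary.Definitions using (Decidable)
open import Relation.Binary.PropositionalEquality using (_≡_)
open import Function.Bundles using (_⇔_)

record FiniteField (c ℓ : Level) : Set (lsuc (c ⊔ ℓ)) where
  field
    commutativeRing : CommutativeRing c ℓ
  open CommutativeRing commutativeRing public
  field
    _≟_             : Decidable _≈_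
    0#≉1#           : ¬ (0# ≈ 1#)
    inverse         : ∀ x → ¬ (x ≈ 0#) → ∃ λ y → x * y ≈ 1#
    size            : ℕ
    enum            : Fin size → Carrier
    enum-injective  : ∀ i j → enum i ≈ enum j → i ≡ j
    enum-surjective : ∀ x → ∃ λ i → enum i ≈ x

module LinAlg {c ℓ : Level} (F : FiniteField c ℓ) where
  open FiniteField F

  q : ℕ
  q = size

  Vec : ℕ → Set c
  Vec n = Fin n → Carrier

  Mat : ℕ → ℕ → Set c
  Mat m n = Fin m → Fin n → Carrier

  sumF : ∀ n → (Fin n → Carrier) → Carrier
  sumF zero    f = 0#
  sumF (suc n) f = f Data.Fin.zero + sumF n (λ i → f (Data.Fin.suc i))

  _≈ᵥ_ : ∀ {n} → Vec n → Vec n → Set ℓ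
  u ≈ᵥ v = ∀ j → u j ≈ v j

  zeroᵥ : ∀ {n} → Vec n
  zeroᵥ _ = 0#

  _·ᵥ_ : ∀ {m n} → Vec m → Mat m n → Vec n
  _·ᵥ_ {m} x V j = sumF m (λ i → x i * V i j)

  _·ₘ_ : ∀ {m n p} → Mat m n → Mat n p → Mat m p
  _·ₘ_ {m} {n} A B i j = sumF n (λ l → A i l * B l j)

  δ : ∀ {n} → Fin n → Fin n → Carrier
  δ i j = if ⌊ toℕ i ℕ.≟ toℕ j ⌋ then 1# else 0#

  identity : ∀ {n} → Mat n n
  identity = δ

  _^ₘ_ : ∀ {n} → Mat n n → ℕ → Mat n n
  A ^ₘ zero  = identity
  A ^ₘ suc e = (A ^ₘ e) ·ₘ A

  _∣∣_ : ∀ {m n₁ n₂} → Mat m n₁ → Mat m n₂ → Mat m (n₁ ℕ.+ n₂)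
  _∣∣_ {n₁ = n₁} V₁ V₂ i j with splitAt n₁ j
  ... | inj₁ j₁ = V₁ i j₁
  ... | inj₂ j₂ = V₂ i j₂

  blockDiag : ∀ {n₁ n₂} → Mat n₁ n₁ → Mat n₂ n₂ → Mat (n₁ ℕ.+ n₂) (n₁ ℕ.+ n₂)
  blockDiag {n₁} A B i j with splitAt n₁ i | splitAt n₁ j
  ... | inj₁ i₁ | inj₁ j₁ = A i₁ j₁
  ... | inj₂ i₂ | inj₂ j₂ = B i₂ j₂
  ... | _       | _       = 0#

  -- rk(V) = m for an m×n matrix V (its m rows are linearly independent)
  FullRowRank : ∀ {m n} → Mat m n → Set (c ⊔ ℓ)
  FullRowRank {m} V = ∀ (x : Vec m) → (x ·ᵥ V) ≈ᵥ zeroᵥ → x ≈ᵥ zeroᵥ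

  -- Subspaces given as row spaces rowsp(V) of generator matrices.

  _∈rowsp_ : ∀ {m n} → Vec n → Mat m n → Set (c ⊔ ℓ)
  _∈rowsp_ {m} v V = ∃ λ (x : Vec m) → v ≈ᵥ (x ·ᵥ V)

  _≃ₛ_ : ∀ {m n} → Mat m n → Mat m n → Set (c ⊔ ℓ)
  V ≃ₛ W = ∀ v → (v ∈rowsp V) ⇔ (v ∈rowsp W)

  TrivialIntersection : ∀ {m n} → Mat m n → Mat m n → Set (c ⊔ ℓ)
  TrivialIntersection V W = ∀ v → v ∈rowsp V → v ∈rowsp W → v ≈ᵥ zeroᵥ

  -- The orbit Orb_⟨A⟩(rowsp U) = { rowsp(U A^e) | e ∈ ℕ }, as a predicate
  -- on generator matrices (m×n matrices whose row space lies in the orbit).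
  -- (⟨A⟩ = {A^e | e ∈ ℕ} since A has finite order.)
  InOrbit : ∀ {m n} → Mat n n → Mat m n → Mat m n → Set (c ⊔ ℓ)
  InOrbit A U V = ∃ λ (e : ℕ) → V ≃ₛ (U ·ₘ (A ^ₘ e))

  -- A set C of subspaces of F^n (given by m-row generator matrices, up to
  -- ≃ₛ) is a partial spread of dimension m: every member has dimension m,
  -- C has at least two (distinct) members, and distinct members intersect
  -- trivially (equivalently have subspace distance 2m).
  IsPartialSpread : ∀ {m n} → (Mat m n → Set (c ⊔ ℓ)) → Set (c ⊔ ℓ)
  IsPartialSpread {m} {n} C =
      (∀ V → C V → FullRowRank V)
    × (∃ λ (V : Mat m n) → ∃ λ (W : Mat m n) → C V × C W × ¬ (V ≃ₛ W))
    × (∀ V W → C V → C W → ¬ (V ≃ₛ W) → TrivialIntersection V W)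

  HasCardinality : ∀ {m n} → (Mat m n → Set (c ⊔ ℓ)) → ℕ → Set (c ⊔ ℓ)
  HasCardinality {m} {n} C N =
    Σ (Fin N → Mat m n) λ f →
        (∀ i → C (f i))
      × (∀ i j → f i ≃ₛ f j → i ≡ j)
      × (∀ V → C V → ∃ λ i → V ≃ₛ f i)

  -- Monic polynomials of degree d+1:  x^(d+1) + a_d x^d + … + a_1 x + a_0,
  -- represented by the coefficient vector a = (a_0 , … , a_d).

  MonicPoly : ℕ → Set c
  MonicPoly d = Vec (suc d)

  -- Companion matrix (row convention, acting on row vectors from the right):
  -- row i is e_(i+1) for i < d, the last row is (-a_0, …, -a_d).
  companion : ∀ {d} → MonicPoly d → Mat (suc d) (suc d)
  companion {d} a i j =
    if ⌊ toℕ i ℕ.<? d ⌋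
      then (if ⌊ toℕ j ℕ.≟ suc (toℕ i) ⌋ then 1# else 0#)
      else - a j

  -- The remainder of x^e modulo f (f monic of degree d+1), as the
  -- coefficient vector with respect to 1, x, …, x^d.
  shiftX : ∀ {d} → Vec (suc d) → Vec (suc d)
  shiftX r Data.Fin.zero    = 0#
  shiftX r (Data.Fin.suc j) = r (Data.Fin.inject₁ j)

  xPowMod : ∀ {d} → MonicPoly d → ℕ → Vec (suc d)
  xPowMod a zero    = δ Data.Fin.zero
  xPowMod {d} a (suc e) j =
    shiftX r j - (r (Data.Fin.fromℕ d) * a j)
    where r = xPowMod a e

  DividesXPowMinus1 : ∀ {d} → MonicPoly d → ℕ → Set ℓ
  DividesXPowMinus1 a e = xPowMod a e ≈ᵥ δ Data.Fin.zero

  HasOrder : ∀ {d} → MonicPoly d → ℕ → Set ℓ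
  HasOrder a N = (1 ℕ.≤ N) × DividesXPowMinus1 a N
               × (∀ e → 1 ℕ.≤ e → e ℕ.< N → ¬ DividesXPowMinus1 a e)

  -- f of degree m = d+1 is primitive over F_q iff f is monic, f(0) ≠ 0
  -- and ord(f) = q^m − 1  (Lidl–Niederreiter, Thm. 3.16).
  Primitive : ∀ {d} → MonicPoly d → Set ℓ
  Primitive {d} a = ¬ (a Data.Fin.zero ≈ 0#) × HasOrder a (q ℕ.^ suc d ℕ.∸ 1)

  gen : ∀ k → MonicPoly k → Mat (k ℕ.+ suc k) (k ℕ.+ suc k)
  gen k a = blockDiag (identity {k}) (companion a)

{-# OPTIONS --safe #-}
-- The companion matrix M of f has order N = q^(k+1) − 1, and its powers act freely and
-- transitively on the nonzero vectors of F^(k+1) (the action ⋆ below). The rows of the orbit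
-- member W e = (U₁ ∣∣ U₂) g^e are the vectors y U₁ ++ y U₂ M^e.
--
-- If U₁ and U₂ have full rank, a vector lying in W e and W e′ has the same coefficient vector
-- y in both, so y U₂ M^e = y U₂ M^e′, which forces y = 0 or e ≡ e′ (mod N). Hence the members
-- W 0, …, W (N − 1) are distinct and meet pairwise trivially.
--
-- Conversely, in a partial spread no nonzero vector lies in every member. Since a ++ 0 lies in
-- every member as soon as it lies in W 0, U₂ has full rank. If x U₁ = 0 but b = x U₂ ≠ 0, pick
-- a row u ++ c of U with u ≠ 0 (for U₁ = 0 a dimension count applies instead). Transitivity
-- gives c M^e = c + b with e ≢ 0, so u ++ (c + b) is common to W 0 and W e and the two members
-- coincide; this makes u ++ 0 a vector of W 0, contradicting u ≠ 0.
module Submission where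

open import Defs
open import Level using (Level; _⊔_)
open import Algebra.Bundles using (AbelianGroup)
import Algebra.Construct.Pointwise as Pointwise
import Algebra.Properties.AbelianGroup as AbelianGroupProperties
open import Data.Nat as ℕ using (ℕ; zero; suc; _∸_; _^_; _<_; _≤_)
import Data.Nat.Properties as ℕ
open import Data.Nat.DivMod using (_%_; _/_; m≡m%n+[m/n]*n; m%n<n; m<n⇒m%n≡m; m%n%n≡m%n; [m+kn]%n≡m%n)
open import Data.Fin as Fin using (Fin; zero; suc; toℕ; _↑ˡ_; _↑ʳ_; splitAt)
import Data.Fin.Properties as Fin
open import Data.Vec.Functional using (_++_; take; drop; _∷_)
import Data.Vec.Functional.Relation.Binary.Pointwise.Properties as Pointwise≈
import Data.Vec.Functional.Properties as Dᵥ
open import Data.Product using (∃; ∃₂; _×_; _,_; proj₁; proj₂)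
open import Data.Sum using (_⊎_; inj₁; inj₂; [_,_]′)
open import Data.Empty using (⊥; ⊥-elim)
open import Data.Bool using (if_then_else_)
open import Function using (_∘_; id)
open import Relation.Nullary using (¬_; Dec; yes; no)
open import Relation.Nullary.Decidable using (⌊_⌋)
open import Relation.Binary.PropositionalEquality as ≡ using (_≡_; _≢_)
import Relation.Binary.Reasoning.Setoid as SetoidReasoning
open import Relation.Binary.Structures using (IsEquivalence)
open import Function.Bundles using (_⇔_; mk⇔; Equivalence)
import Function.Properties.Equivalence as ⇔-Properties

Fin-injective⇒surjective : ∀ {n} (h : Fin n → Fin n) → (∀ {i j} → h i ≡ h j → i ≡ j) →
                           ∀ t → ∃ λ i → h i ≡ t
Fin-injective⇒surjective {suc n} h h-injective t with Fin.any? (λ i → h i Fin.≟ t)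
... | yes hit = hit
... | no miss = ⊥-elim (ℕ.1+n≰n (Fin.injective⇒≤ punchOut∘h-injective))
  where
  t≢h : ∀ i → t ≢ h i
  t≢h i t≡hi = miss (i , ≡.sym t≡hi)
  punchOut∘h-injective : ∀ {i j} → Fin.punchOut (t≢h i) ≡ Fin.punchOut (t≢h j) → i ≡ j
  punchOut∘h-injective eq = h-injective (Fin.punchOut-injective (t≢h _) (t≢h _) eq)

module Matrices {c ℓ : Level} (F : FiniteField c ℓ) where
  open FiniteField F hiding (zero)
  open LinAlg F public renaming
    ( _≈ᵥ_ to infix 4 _≈ᵥ_; _·ᵥ_ to infixl 7 _·ᵥ_; _·ₘ_ to infixl 7 _·ₘ_; _^ₘ_ to infixr 8 _^ₘ_
    ; _∈rowsp_ to infix 4 _∈rowsp_; _≃ₛ_ to infix 4 _≃ₛ_ )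
  open import Algebra.Properties.Semiring.Sum semiring
    using (sum; sum-cong-≋; ∑-distrib-+; ∑-comm; *-distribˡ-sum; *-distribʳ-sum; sum-init-last; sum-replicate-zero)
  open import Algebra.Properties.Ring ring using (-0#≈0#; -‿+-comm; -‿distribˡ-*; x[y-z]≈xy-xz)
  module ≈-Reasoning = SetoidReasoning setoid
  module ⇔ = IsEquivalence (⇔-Properties.⇔-isEquivalence {c ⊔ ℓ})

  vecGroup : ℕ → AbelianGroup c ℓ
  vecGroup n = Pointwise.abelianGroup (Fin n) +-abelianGroup

  open module VecGroup {n} = AbelianGroup (vecGroup n) public
    using ()
    renaming ( _∙_ to infixl 6 _+ᵥ_; _⁻¹ to -ᵥ_; _-_ to _-ᵥ_
             ; refl to ≈ᵥ-refl; sym to ≈ᵥ-sym; trans to ≈ᵥ-trans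
             ; ∙-cong to +ᵥ-cong; ⁻¹-cong to -ᵥ-cong
             ; identityˡ to +ᵥ-identityˡ; identityʳ to +ᵥ-identityʳ; inverseʳ to -ᵥ-inverseʳ )
  open module VecGroupProperties {n} = AbelianGroupProperties (vecGroup n) public
    using ()
    renaming ( x∙y⁻¹≈ε⇒x≈y to -ᵥ≈0⇒≈; x≈y⇒x∙y⁻¹≈ε to ≈⇒-ᵥ≈0; inverseˡ-unique to +ᵥ≈0⇒≈-ᵥ
             ; identityʳ-unique to +ᵥ-identityʳ-unique; ⁻¹-injective to -ᵥ-injective; ε⁻¹≈ε to -ᵥ0≈0 )
  module ≈ᵥ-Reasoning {n} = SetoidReasoning (AbelianGroup.setoid (vecGroup n))

  ⌊suc≟suc⌋ : ∀ a b → ⌊ suc a ℕ.≟ suc b ⌋ ≡ ⌊ a ℕ.≟ b ⌋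
  ⌊suc≟suc⌋ a b with suc a ℕ.≟ suc b | a ℕ.≟ b
  ... | yes _   | yes _   = ≡.refl
  ... | no  _   | no  _   = ≡.refl
  ... | yes a≡b | no  a≢b = ⊥-elim (a≢b (ℕ.suc-injective a≡b))
  ... | no  a≢b | yes a≡b = ⊥-elim (a≢b (≡.cong suc a≡b))

  ⌊≟⌋-sym : ∀ a b → ⌊ a ℕ.≟ b ⌋ ≡ ⌊ b ℕ.≟ a ⌋
  ⌊≟⌋-sym a b with a ℕ.≟ b | b ℕ.≟ a
  ... | yes _   | yes _   = ≡.refl
  ... | no  _   | no  _   = ≡.refl
  ... | yes a≡b | no  b≢a = ⊥-elim (b≢a (≡.sym a≡b))
  ... | no  a≢b | yes b≡a = ⊥-elim (a≢b (≡.sym b≡a))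

  δ-suc : ∀ {n} (i j : Fin n) → δ (suc i) (suc j) ≡ δ i j
  δ-suc i j = ≡.cong (if_then 1# else 0#) (⌊suc≟suc⌋ (toℕ i) (toℕ j))

  δ-sym : ∀ {n} (i j : Fin n) → δ i j ≡ δ j i
  δ-sym i j = ≡.cong (if_then 1# else 0#) (⌊≟⌋-sym (toℕ i) (toℕ j))

  δ-nonzero : ∀ {n} (i : Fin n) → ¬ δ i ≈ᵥ zeroᵥ
  δ-nonzero i δᵢ≈0 = 0#≉1# (sym (trans (reflexive δᵢᵢ≡1) (δᵢ≈0 i)))
    where
    δᵢᵢ≡1 : 1# ≡ δ i i
    δᵢᵢ≡1 = ≡.cong (if_then 1# else 0#) (≡.cong ⌊_⌋ (≡.sym (ℕ.≟-diag ≡.refl)))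

  -- Finite sums

  sumF≡sum : ∀ n (f : Fin n → Carrier) → sumF n f ≡ sum f
  sumF≡sum zero    f = ≡.refl
  sumF≡sum (suc n) f = ≡.cong (f zero +_) (sumF≡sum n (f ∘ suc))

  sumF-cong : ∀ n {f g : Fin n → Carrier} → (∀ i → f i ≈ g i) → sumF n f ≈ sumF n g
  sumF-cong n {f} {g} f≈g rewrite sumF≡sum n f | sumF≡sum n g = sum-cong-≋ f≈g

  sumF-zero : ∀ n {f : Fin n → Carrier} → (∀ i → f i ≈ 0#) → sumF n f ≈ 0#
  sumF-zero n {f} f≈0 rewrite sumF≡sum n f = trans (sum-cong-≋ f≈0) (sum-replicate-zero n)

  sumF-+ : ∀ n (f g : Fin n → Carrier) → sumF n (λ i → f i + g i) ≈ sumF n f + sumF n g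
  sumF-+ n f g rewrite sumF≡sum n (λ i → f i + g i) | sumF≡sum n f | sumF≡sum n g = ∑-distrib-+ f g

  sumF-*ˡ : ∀ n a (f : Fin n → Carrier) → sumF n (λ i → a * f i) ≈ a * sumF n f
  sumF-*ˡ n a f rewrite sumF≡sum n (λ i → a * f i) | sumF≡sum n f = sym (*-distribˡ-sum a f)

  sumF-*ʳ : ∀ n a (f : Fin n → Carrier) → sumF n (λ i → f i * a) ≈ sumF n f * a
  sumF-*ʳ n a f rewrite sumF≡sum n (λ i → f i * a) | sumF≡sum n f = sym (*-distribʳ-sum a f)

  sumF-neg : ∀ n (f : Fin n → Carrier) → sumF n (λ i → - f i) ≈ - sumF n f
  sumF-neg zero    f = sym -0#≈0#
  sumF-neg (suc n) f = trans (+-congˡ (sumF-neg n (f ∘ suc))) (-‿+-comm _ _)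

  sumF-comm : ∀ m n (f : Fin m → Fin n → Carrier) →
              sumF m (λ i → sumF n (f i)) ≈ sumF n (λ j → sumF m (λ i → f i j))
  sumF-comm m n f = begin
    sumF m (λ i → sumF n (f i))          ≡⟨ sumF≡sum m (λ i → sumF n (f i)) ⟩
    sum (λ i → sumF n (f i))             ≈⟨ sum-cong-≋ (λ i → reflexive (sumF≡sum n (f i))) ⟩
    sum (λ i → sum (f i))                ≈⟨ ∑-comm f ⟩
    sum (λ j → sum (λ i → f i j))        ≈⟨ sum-cong-≋ (λ j → reflexive (sumF≡sum m (λ i → f i j))) ⟨
    sum (λ j → sumF m (λ i → f i j))     ≡⟨ sumF≡sum n (λ j → sumF m (λ i → f i j)) ⟨
    sumF n (λ j → sumF m (λ i → f i j))  ∎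
    where open ≈-Reasoning

  sumF-++ : ∀ m n (f : Fin (m ℕ.+ n) → Carrier) →
            sumF (m ℕ.+ n) f ≈ sumF m (λ i → f (i ↑ˡ n)) + sumF n (λ j → f (m ↑ʳ j))
  sumF-++ zero    n f = sym (+-identityˡ _)
  sumF-++ (suc m) n f = trans (+-congˡ (sumF-++ m n (f ∘ suc))) (sym (+-assoc _ _ _))

  sumF-init-last : ∀ n (f : Fin (suc n) → Carrier) →
                   sumF (suc n) f ≈ sumF n (f ∘ Fin.inject₁) + f (Fin.fromℕ n)
  sumF-init-last n f rewrite sumF≡sum (suc n) f | sumF≡sum n (f ∘ Fin.inject₁) = sum-init-last f

  sumF-δʳ : ∀ n (x : Fin n → Carrier) j → sumF n (λ i → x i * δ i j) ≈ x j
  sumF-δʳ (suc n) x zero = begin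
    x zero * 1# + sumF n (λ i → x (suc i) * 0#)  ≈⟨ +-cong (*-identityʳ _) (sumF-zero n (λ _ → zeroʳ _)) ⟩
    x zero + 0#                                  ≈⟨ +-identityʳ _ ⟩
    x zero                                       ∎
    where open ≈-Reasoning
  sumF-δʳ (suc n) x (suc j) = begin
    x zero * 0# + sumF n (λ i → x (suc i) * δ (suc i) (suc j))
      ≈⟨ +-cong (zeroʳ _) (sumF-cong n (λ i → *-congˡ (reflexive (δ-suc i j)))) ⟩
    0# + sumF n (λ i → x (suc i) * δ i j)
      ≈⟨ +-identityˡ _ ⟩
    sumF n (λ i → x (suc i) * δ i j)
      ≈⟨ sumF-δʳ n (x ∘ suc) j ⟩
    x (suc j) ∎
    where open ≈-Reasoning

  sumF-δˡ : ∀ n (x : Fin n → Carrier) j → sumF n (λ i → δ j i * x i) ≈ x j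
  sumF-δˡ n x j =
    trans (sumF-cong n (λ i → trans (*-comm _ _) (*-congˡ (reflexive (δ-sym j i))))) (sumF-δʳ n x j)

  ·ᵥ-congˡ : ∀ {m n} {x y : Vec m} (A : Mat m n) → x ≈ᵥ y → x ·ᵥ A ≈ᵥ y ·ᵥ A
  ·ᵥ-congˡ {m} A x≈y j = sumF-cong m (λ i → *-congʳ (x≈y i))

  ·ᵥ-congʳ : ∀ {m n} (x : Vec m) {A B : Mat m n} → (∀ i → A i ≈ᵥ B i) → x ·ᵥ A ≈ᵥ x ·ᵥ B
  ·ᵥ-congʳ {m} x A≈B j = sumF-cong m (λ i → *-congˡ (A≈B i j))

  ·ᵥ-distrib-+ᵥ : ∀ {m n} (x y : Vec m) (A : Mat m n) → (x +ᵥ y) ·ᵥ A ≈ᵥ x ·ᵥ A +ᵥ y ·ᵥ A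
  ·ᵥ-distrib-+ᵥ {m} x y A j =
    trans (sumF-cong m (λ i → distribʳ (A i j) (x i) (y i))) (sumF-+ m _ _)

  ·ᵥ-neg : ∀ {m n} (x : Vec m) (A : Mat m n) → (-ᵥ x) ·ᵥ A ≈ᵥ -ᵥ (x ·ᵥ A)
  ·ᵥ-neg {m} x A j = trans (sumF-cong m (λ i → sym (-‿distribˡ-* (x i) (A i j)))) (sumF-neg m _)

  ·ᵥ-distrib--ᵥ : ∀ {m n} (x y : Vec m) (A : Mat m n) → (x -ᵥ y) ·ᵥ A ≈ᵥ x ·ᵥ A -ᵥ y ·ᵥ A
  ·ᵥ-distrib--ᵥ x y A = ≈ᵥ-trans (·ᵥ-distrib-+ᵥ x (-ᵥ y) A) (+ᵥ-cong ≈ᵥ-refl (·ᵥ-neg y A))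

  infixl 6 _-ₘ_
  _-ₘ_ : ∀ {m n} → Mat m n → Mat m n → Mat m n
  (A -ₘ B) i = A i -ᵥ B i

  ·ᵥ-distrib--ₘ : ∀ {m n} (x : Vec m) (A B : Mat m n) → x ·ᵥ (A -ₘ B) ≈ᵥ x ·ᵥ A -ᵥ x ·ᵥ B
  ·ᵥ-distrib--ₘ {m} x A B j = begin
    sumF m (λ i → x i * (A i j - B i j))          ≈⟨ sumF-cong m (λ i → x[y-z]≈xy-xz (x i) _ _) ⟩
    sumF m (λ i → x i * A i j - x i * B i j)      ≈⟨ sumF-+ m _ _ ⟩
    (x ·ᵥ A) j + sumF m (λ i → - (x i * B i j))   ≈⟨ +-congˡ (sumF-neg m _) ⟩
    (x ·ᵥ A) j - (x ·ᵥ B) j                       ∎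
    where open ≈-Reasoning

  ·ᵥ-zero-rows : ∀ {m n} (x : Vec m) {A : Mat m n} → (∀ i → A i ≈ᵥ zeroᵥ) → x ·ᵥ A ≈ᵥ zeroᵥ
  ·ᵥ-zero-rows {m} x A≈0 j = sumF-zero m (λ i → trans (*-congˡ (A≈0 i j)) (zeroʳ _))

  ·ᵥ-zeroˡ : ∀ {m n} (A : Mat m n) → zeroᵥ ·ᵥ A ≈ᵥ zeroᵥ
  ·ᵥ-zeroˡ {m} A j = sumF-zero m (λ i → zeroˡ (A i j))

  ·ᵥ-assoc : ∀ {m n p} (x : Vec m) (A : Mat m n) (B : Mat n p) → x ·ᵥ (A ·ₘ B) ≈ᵥ x ·ᵥ A ·ᵥ B
  ·ᵥ-assoc {m} {n} x A B j = begin
    sumF m (λ i → x i * sumF n (λ l → A i l * B l j))    ≈⟨ sumF-cong m (λ i → sym (sumF-*ˡ n (x i) _)) ⟩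
    sumF m (λ i → sumF n (λ l → x i * (A i l * B l j)))  ≈⟨ sumF-comm m n _ ⟩
    sumF n (λ l → sumF m (λ i → x i * (A i l * B l j)))  ≈⟨ sumF-cong n (λ l → sumF-cong m (λ i → sym (*-assoc _ _ _))) ⟩
    sumF n (λ l → sumF m (λ i → x i * A i l * B l j))    ≈⟨ sumF-cong n (λ l → sumF-*ʳ m (B l j) _) ⟩
    sumF n (λ l → sumF m (λ i → x i * A i l) * B l j)    ∎
    where open ≈-Reasoning

  ·ᵥ-identity : ∀ {n} (x : Vec n) → x ·ᵥ identity ≈ᵥ x
  ·ᵥ-identity {n} x = sumF-δʳ n x

  δ-·ᵥ : ∀ {m n} (i : Fin m) (A : Mat m n) → δ i ·ᵥ A ≈ᵥ A i
  δ-·ᵥ {m} i A j = sumF-δˡ m (λ l → A l j) i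

  -- Block vectors and block matrices

  ++-ext : ∀ {m n} {v : Vec (m ℕ.+ n)} {a : Vec m} {z : Vec n} →
           take m v ≈ᵥ a → drop m v ≈ᵥ z → v ≈ᵥ a ++ z
  ++-ext {m} {v = v} {a} {z} v₁≈a v₂≈z j with splitAt m j in eq
  ... | inj₁ i = ≡.subst (λ t → v t ≈ a i) (Fin.splitAt⁻¹-↑ˡ eq) (v₁≈a i)
  ... | inj₂ i = ≡.subst (λ t → v t ≈ z i) (Fin.splitAt⁻¹-↑ʳ eq) (v₂≈z i)

  ++-cong : ∀ {m n} {a a′ : Vec m} {z z′ : Vec n} → a ≈ᵥ a′ → z ≈ᵥ z′ → a ++ z ≈ᵥ a′ ++ z′
  ++-cong = Pointwise≈.++⁺ _≈_

  ++-injective : ∀ {m n} {a a′ : Vec m} {z z′ : Vec n} → a ++ z ≈ᵥ a′ ++ z′ → a ≈ᵥ a′ × z ≈ᵥ z′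
  ++-injective = Pointwise≈.++⁻ _≈_ _ _

  zeroᵥ-++ : ∀ {m n} → zeroᵥ ≈ᵥ zeroᵥ {m} ++ zeroᵥ {n}
  zeroᵥ-++ {m} = ++-ext {m} (λ _ → refl) (λ _ → refl)

  ·ᵥ-∣∣ : ∀ {p m n} (x : Vec p) (V₁ : Mat p m) (V₂ : Mat p n) → x ·ᵥ (V₁ ∣∣ V₂) ≈ᵥ x ·ᵥ V₁ ++ x ·ᵥ V₂
  ·ᵥ-∣∣ {m = m} x V₁ V₂ j with splitAt m j
  ... | inj₁ _ = refl
  ... | inj₂ _ = refl

  ++-+ᵥ : ∀ {m n} (a a′ : Vec m) (z z′ : Vec n) → (a ++ z) +ᵥ (a′ ++ z′) ≈ᵥ (a +ᵥ a′) ++ (z +ᵥ z′)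
  ++-+ᵥ {m} a a′ z z′ j with splitAt m j
  ... | inj₁ _ = refl
  ... | inj₂ _ = refl

  take-++ : ∀ {m n} (a : Vec m) (z : Vec n) → take m (a ++ z) ≈ᵥ a
  take-++ a z i = reflexive (Dᵥ.lookup-++ˡ a z i)

  drop-++ : ∀ {m n} (a : Vec m) (z : Vec n) → drop m (a ++ z) ≈ᵥ z
  drop-++ a z i = reflexive (Dᵥ.lookup-++ʳ a z i)

  ·ᵥ-stack : ∀ {m m′ n} (x : Vec (m ℕ.+ m′)) (A : Mat m n) (B : Mat m′ n) →
             x ·ᵥ (A ++ B) ≈ᵥ take m x ·ᵥ A +ᵥ drop m x ·ᵥ B
  ·ᵥ-stack {m} {m′} x A B j = trans (sumF-++ m m′ (λ i → x i * (A ++ B) i j))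
    (+-cong (sumF-cong m (λ i → *-congˡ (reflexive (≡.cong (λ r → r j) (Dᵥ.lookup-++ˡ A B i)))))
            (sumF-cong m′ (λ i → *-congˡ (reflexive (≡.cong (λ r → r j) (Dᵥ.lookup-++ʳ A B i))))))

  zeroₘ : ∀ {m n} → Mat m n
  zeroₘ _ = zeroᵥ

  blockDiag-blocks : ∀ {m n} (A : Mat m m) (B : Mat n n) i →
                     blockDiag A B i ≈ᵥ ((A ∣∣ zeroₘ) ++ (zeroₘ ∣∣ B)) i
  blockDiag-blocks {m} A B i j with splitAt m i
  ... | inj₁ _ with splitAt m j
  ...   | inj₁ _ = refl
  ...   | inj₂ _ = refl
  blockDiag-blocks {m} A B i j | inj₂ _ with splitAt m j
  ...   | inj₁ _ = refl
  ...   | inj₂ _ = refl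

  ++-·ᵥ-blockDiag : ∀ {m n} (a : Vec m) (z : Vec n) (A : Mat m m) (B : Mat n n) →
                    (a ++ z) ·ᵥ blockDiag A B ≈ᵥ a ·ᵥ A ++ z ·ᵥ B
  ++-·ᵥ-blockDiag {m} a z A B = begin
    (a ++ z) ·ᵥ blockDiag A B
      ≈⟨ ·ᵥ-congʳ (a ++ z) (blockDiag-blocks A B) ⟩
    (a ++ z) ·ᵥ ((A ∣∣ zeroₘ) ++ (zeroₘ ∣∣ B))
      ≈⟨ ·ᵥ-stack (a ++ z) (A ∣∣ zeroₘ) (zeroₘ ∣∣ B) ⟩
    take m (a ++ z) ·ᵥ (A ∣∣ zeroₘ) +ᵥ drop m (a ++ z) ·ᵥ (zeroₘ ∣∣ B)
      ≈⟨ +ᵥ-cong (·ᵥ-congˡ (A ∣∣ zeroₘ) (take-++ a z)) (·ᵥ-congˡ (zeroₘ ∣∣ B) (drop-++ a z)) ⟩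
    a ·ᵥ (A ∣∣ zeroₘ) +ᵥ z ·ᵥ (zeroₘ ∣∣ B)
      ≈⟨ +ᵥ-cong (·ᵥ-∣∣ a A zeroₘ) (·ᵥ-∣∣ z zeroₘ B) ⟩
    (a ·ᵥ A ++ a ·ᵥ zeroₘ) +ᵥ (z ·ᵥ zeroₘ ++ z ·ᵥ B)
      ≈⟨ ++-+ᵥ (a ·ᵥ A) (z ·ᵥ zeroₘ) (a ·ᵥ zeroₘ) (z ·ᵥ B) ⟩
    (a ·ᵥ A +ᵥ z ·ᵥ zeroₘ) ++ (a ·ᵥ zeroₘ +ᵥ z ·ᵥ B)
      ≈⟨ ++-cong {m} (≈ᵥ-trans (+ᵥ-cong ≈ᵥ-refl (·ᵥ-zero-rows z (λ _ → ≈ᵥ-refl))) (+ᵥ-identityʳ _))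
                 (≈ᵥ-trans (+ᵥ-cong (·ᵥ-zero-rows a (λ _ → ≈ᵥ-refl)) ≈ᵥ-refl) (+ᵥ-identityˡ _)) ⟩
    a ·ᵥ A ++ z ·ᵥ B ∎
    where open ≈ᵥ-Reasoning

  -- Matrix powers

  ·ᵥ-^ₘ-+ : ∀ {n} (x : Vec n) (A : Mat n n) a b → x ·ᵥ A ^ₘ (a ℕ.+ b) ≈ᵥ x ·ᵥ A ^ₘ b ·ᵥ A ^ₘ a
  ·ᵥ-^ₘ-+ x A zero    b = ≈ᵥ-sym (·ᵥ-identity _)
  ·ᵥ-^ₘ-+ x A (suc a) b = begin
    x ·ᵥ (A ^ₘ (a ℕ.+ b) ·ₘ A)    ≈⟨ ·ᵥ-assoc x (A ^ₘ (a ℕ.+ b)) A ⟩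
    x ·ᵥ A ^ₘ (a ℕ.+ b) ·ᵥ A      ≈⟨ ·ᵥ-congˡ A (·ᵥ-^ₘ-+ x A a b) ⟩
    x ·ᵥ A ^ₘ b ·ᵥ A ^ₘ a ·ᵥ A    ≈⟨ ·ᵥ-assoc (x ·ᵥ A ^ₘ b) (A ^ₘ a) A ⟨
    x ·ᵥ A ^ₘ b ·ᵥ A ^ₘ suc a     ∎
    where open ≈ᵥ-Reasoning

  ·ᵥ-^ₘ-comm : ∀ {n} (x : Vec n) (A : Mat n n) a b → x ·ᵥ A ^ₘ a ·ᵥ A ^ₘ b ≈ᵥ x ·ᵥ A ^ₘ b ·ᵥ A ^ₘ a
  ·ᵥ-^ₘ-comm x A a b = begin
    x ·ᵥ A ^ₘ a ·ᵥ A ^ₘ b    ≈⟨ ·ᵥ-^ₘ-+ x A b a ⟨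
    x ·ᵥ A ^ₘ (b ℕ.+ a)      ≡⟨ ≡.cong (λ e → x ·ᵥ A ^ₘ e) (ℕ.+-comm b a) ⟩
    x ·ᵥ A ^ₘ (a ℕ.+ b)      ≈⟨ ·ᵥ-^ₘ-+ x A a b ⟩
    x ·ᵥ A ^ₘ b ·ᵥ A ^ₘ a    ∎
    where open ≈ᵥ-Reasoning

  ·ᵥ-^ₘ-suc : ∀ {n} (x : Vec n) (A : Mat n n) e → x ·ᵥ A ^ₘ suc e ≈ᵥ x ·ᵥ A ·ᵥ A ^ₘ e
  ·ᵥ-^ₘ-suc x A e = begin
    x ·ᵥ A ^ₘ suc e             ≡⟨ ≡.cong (λ d → x ·ᵥ A ^ₘ d) (ℕ.+-comm 1 e) ⟩
    x ·ᵥ A ^ₘ (e ℕ.+ 1)         ≈⟨ ·ᵥ-^ₘ-+ x A e 1 ⟩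
    x ·ᵥ (identity ·ₘ A) ·ᵥ A ^ₘ e ≈⟨ ·ᵥ-congˡ (A ^ₘ e) (·ᵥ-assoc x identity A) ⟩
    x ·ᵥ identity ·ᵥ A ·ᵥ A ^ₘ e   ≈⟨ ·ᵥ-congˡ (A ^ₘ e) (·ᵥ-congˡ A (·ᵥ-identity x)) ⟩
    x ·ᵥ A ·ᵥ A ^ₘ e            ∎
    where open ≈ᵥ-Reasoning

  ++-·ᵥ-blockDiag-identity-^ₘ : ∀ {m n} (a : Vec m) (z : Vec n) (B : Mat n n) e →
                                (a ++ z) ·ᵥ blockDiag identity B ^ₘ e ≈ᵥ a ++ z ·ᵥ B ^ₘ e
  ++-·ᵥ-blockDiag-identity-^ₘ {m} a z B zero =
    ≈ᵥ-trans (·ᵥ-identity (a ++ z)) (++-cong {m} ≈ᵥ-refl (≈ᵥ-sym (·ᵥ-identity z)))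
  ++-·ᵥ-blockDiag-identity-^ₘ {m} {n} a z B (suc e) = begin
    (a ++ z) ·ᵥ (G ^ₘ e ·ₘ G)            ≈⟨ ·ᵥ-assoc (a ++ z) (G ^ₘ e) G ⟩
    (a ++ z) ·ᵥ G ^ₘ e ·ᵥ G              ≈⟨ ·ᵥ-congˡ G (++-·ᵥ-blockDiag-identity-^ₘ a z B e) ⟩
    (a ++ z ·ᵥ B ^ₘ e) ·ᵥ G              ≈⟨ ++-·ᵥ-blockDiag a (z ·ᵥ B ^ₘ e) identity B ⟩
    a ·ᵥ identity ++ z ·ᵥ B ^ₘ e ·ᵥ B    ≈⟨ ++-cong {m} (≈ᵥ-sym (·ᵥ-identity a)) (·ᵥ-assoc z (B ^ₘ e) B) ⟨
    a ++ z ·ᵥ B ^ₘ suc e                 ∎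
    where
    open ≈ᵥ-Reasoning
    G : Mat (m ℕ.+ n) (m ℕ.+ n)
    G = blockDiag identity B

  -- Row spaces

  ≃ₛ-refl : ∀ {m n} {V : Mat m n} → V ≃ₛ V
  ≃ₛ-refl v = ⇔.refl

  ≃ₛ-sym : ∀ {m n} {V W : Mat m n} → V ≃ₛ W → W ≃ₛ V
  ≃ₛ-sym V≃W v = ⇔.sym (V≃W v)

  ≃ₛ-trans : ∀ {m n} {U V W : Mat m n} → U ≃ₛ V → V ≃ₛ W → U ≃ₛ W
  ≃ₛ-trans U≃V V≃W v = ⇔.trans (U≃V v) (V≃W v)

  ∈rowsp-resp : ∀ {m n} {V : Mat m n} {v w : Vec n} → v ≈ᵥ w → v ∈rowsp V → w ∈rowsp V
  ∈rowsp-resp v≈w (x , v≈xV) = x , ≈ᵥ-trans (≈ᵥ-sym v≈w) v≈xV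

  rowsp-≃ : ∀ {m n} {V W : Mat m n} → (∀ x → x ·ᵥ V ≈ᵥ x ·ᵥ W) → V ≃ₛ W
  rowsp-≃ xV≈xW v = mk⇔ (λ (x , v≈xV) → x , ≈ᵥ-trans v≈xV (xV≈xW x))
                        (λ (x , v≈xW) → x , ≈ᵥ-trans v≈xW (≈ᵥ-sym (xV≈xW x)))

module FiniteLinearAlgebra {c ℓ : Level} (F : FiniteField c ℓ) where
  open FiniteField F hiding (zero)
  open Matrices F

  coordinate : Carrier → Fin q
  coordinate x = proj₁ (enum-surjective x)

  enum-coordinate : ∀ x → enum (coordinate x) ≈ x
  enum-coordinate x = proj₂ (enum-surjective x)

  coordinate-cong : ∀ {x y} → x ≈ y → coordinate x ≡ coordinate y
  coordinate-cong {x} {y} x≈y =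
    enum-injective _ _ (trans (enum-coordinate x) (trans x≈y (sym (enum-coordinate y))))

  coordinate-injective : ∀ {x y} → coordinate x ≡ coordinate y → x ≈ y
  coordinate-injective {x} {y} eq =
    trans (sym (enum-coordinate x)) (trans (reflexive (≡.cong enum eq)) (enum-coordinate y))

  coordinate-enum : ∀ i → coordinate (enum i) ≡ i
  coordinate-enum i = enum-injective _ _ (enum-coordinate (enum i))

  index : ∀ {n} → Vec n → Fin (q ^ n)
  index {zero}  v = zero
  index {suc n} v = Fin.combine (coordinate (v zero)) (index (v ∘ suc))

  index-split : ∀ {n} (v w : Vec (suc n)) → index v ≡ index w →
                coordinate (v zero) ≡ coordinate (w zero) × index (v ∘ suc) ≡ index (w ∘ suc)
  index-split v w = Fin.combine-injective _ _ _ _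

  index-cong : ∀ {n} {v w : Vec n} → v ≈ᵥ w → index v ≡ index w
  index-cong {zero}  v≈w = ≡.refl
  index-cong {suc n} v≈w = ≡.cong₂ Fin.combine (coordinate-cong (v≈w zero)) (index-cong (v≈w ∘ suc))

  index-injective : ∀ {n} {v w : Vec n} → index v ≡ index w → v ≈ᵥ w
  index-injective {suc n} {v} {w} eq zero    = coordinate-injective (proj₁ (index-split v w eq))
  index-injective {suc n} {v} {w} eq (suc j) = index-injective (proj₂ (index-split v w eq)) j

  vector : ∀ {n} → Fin (q ^ n) → Vec n
  vector {zero}  _ ()
  vector {suc n} i =
    enum (proj₁ (Fin.remQuot {q} (q ^ n) i)) ∷ vector {n} (proj₂ (Fin.remQuot {q} (q ^ n) i))

  index-vector : ∀ {n} (i : Fin (q ^ n)) → index (vector {n} i) ≡ i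
  index-vector {zero}  zero = ≡.refl
  index-vector {suc n} i = ≡.trans (≡.cong₂ Fin.combine (coordinate-enum r) (index-vector {n} s))
                                   (Fin.combine-remQuot {q} (q ^ n) i)
    where
    r : Fin q
    r = proj₁ (Fin.remQuot {q} (q ^ n) i)
    s : Fin (q ^ n)
    s = proj₂ (Fin.remQuot {q} (q ^ n) i)

  injective⇒surjective : ∀ {n} (h : Fin (q ^ n) → Vec n) → (∀ {i j} → h i ≈ᵥ h j → i ≡ j) →
                         ∀ v → ∃ λ i → h i ≈ᵥ v
  injective⇒surjective h h-injective v
    with i , eq ← Fin-injective⇒surjective (index ∘ h) (h-injective ∘ index-injective) (index v)
    = i , index-injective eq

  pigeonhole : ∀ {m n} → q ^ n < m → (h : Fin m → Vec n) → ∃₂ λ i j → i Fin.< j × h i ≈ᵥ h j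
  pigeonhole qⁿ<m h with i , j , i<j , eq ← Fin.pigeonhole qⁿ<m (index ∘ h) = i , j , i<j , index-injective eq

  1<q : 1 < q
  1<q = Fin.injective⇒≤ {f = zero-one} zero-one-injective
    where
    zero-one : Fin 2 → Fin q
    zero-one zero       = coordinate 0#
    zero-one (suc zero) = coordinate 1#
    zero-one-injective : ∀ {i j} → zero-one i ≡ zero-one j → i ≡ j
    zero-one-injective {zero}     {zero}     _  = ≡.refl
    zero-one-injective {zero}     {suc zero} eq = ⊥-elim (0#≉1# (coordinate-injective eq))
    zero-one-injective {suc zero} {zero}     eq = ⊥-elim (0#≉1# (sym (coordinate-injective eq)))
    zero-one-injective {suc zero} {suc zero} _  = ≡.refl

  vector-injective : ∀ {n} {i j : Fin (q ^ n)} → vector {n} i ≈ᵥ vector j → i ≡ j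
  vector-injective {n} {i} {j} eq =
    ≡.trans (≡.sym (index-vector {n} i)) (≡.trans (index-cong eq) (index-vector {n} j))

  ≈ᵥ0? : ∀ {n} (v : Vec n) → Dec (v ≈ᵥ zeroᵥ)
  ≈ᵥ0? v = Fin.all? (λ j → v j ≟ 0#)

  zero-or-nonzero-row : ∀ {m n} (A : Mat m n) → (∀ i → A i ≈ᵥ zeroᵥ) ⊎ ∃ λ i → ¬ A i ≈ᵥ zeroᵥ
  zero-or-nonzero-row {m} A with Fin.all? (λ i → ≈ᵥ0? (A i))
  ... | yes all-zero = inj₁ all-zero
  ... | no  ¬all-zero = inj₂ (Fin.¬∀⟶∃¬ m _ (λ i → ≈ᵥ0? (A i)) ¬all-zero)

  fullRowRank-cancel : ∀ {m n} {A : Mat m n} → FullRowRank A → ∀ {x y} → x ·ᵥ A ≈ᵥ y ·ᵥ A → x ≈ᵥ y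
  fullRowRank-cancel {A = A} A-rank {x} {y} xA≈yA =
    -ᵥ≈0⇒≈ x y (A-rank (x -ᵥ y) (≈ᵥ-trans (·ᵥ-distrib--ᵥ x y A) (≈⇒-ᵥ≈0 xA≈yA)))

  fullRowRank-^ₘ : ∀ {n} {A : Mat n n} → FullRowRank A → ∀ e → FullRowRank (A ^ₘ e)
  fullRowRank-^ₘ         A-rank zero    x xI≈0 = ≈ᵥ-trans (≈ᵥ-sym (·ᵥ-identity x)) xI≈0
  fullRowRank-^ₘ {A = A} A-rank (suc e) x xAᵉ⁺¹≈0 =
    fullRowRank-^ₘ A-rank e x (A-rank _ (≈ᵥ-trans (≈ᵥ-sym (·ᵥ-assoc x (A ^ₘ e) A)) xAᵉ⁺¹≈0))

  fullRowRank⇒surjective : ∀ {n} {A : Mat n n} → FullRowRank A → ∀ v → ∃ λ x → x ·ᵥ A ≈ᵥ v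
  fullRowRank⇒surjective {n} {A} A-rank v
    with i , eq ← injective⇒surjective (λ i → vector i ·ᵥ A)
                                       (vector-injective ∘ fullRowRank-cancel A-rank) v
    = vector i , eq

  -- The rows of W are the rows of C ·ₘ V for some C, which inherits full rank from W and is
  -- therefore invertible; so x = y ·ᵥ C and y ·ᵥ W ≈ᵥ x ·ᵥ V.
  fullRowRank-resp-≃ : ∀ {m n} {V W : Mat m n} → V ≃ₛ W → FullRowRank W → FullRowRank V
  fullRowRank-resp-≃ {m} {V = V} {W} V≃W W-rank x xV≈0 = begin
    x            ≈⟨ yC≈x ⟨
    y ·ᵥ C       ≈⟨ ·ᵥ-congˡ C (W-rank y (≈ᵥ-trans (≈ᵥ-sym (yCV≈yW y)) (≈ᵥ-trans (·ᵥ-congˡ V yC≈x) xV≈0))) ⟩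
    zeroᵥ ·ᵥ C   ≈⟨ ·ᵥ-zeroˡ C ⟩
    zeroᵥ        ∎
    where
    open ≈ᵥ-Reasoning
    W-in-V : ∀ i → W i ∈rowsp V
    W-in-V i = Equivalence.from (V≃W (W i)) (δ i , ≈ᵥ-sym (δ-·ᵥ i W))
    C : Mat m m
    C i = proj₁ (W-in-V i)
    yCV≈yW : ∀ y → y ·ᵥ C ·ᵥ V ≈ᵥ y ·ᵥ W
    yCV≈yW y = ≈ᵥ-trans (≈ᵥ-sym (·ᵥ-assoc y C V)) (·ᵥ-congʳ y (λ i → ≈ᵥ-sym (proj₂ (W-in-V i))))
    C-rank : FullRowRank C
    C-rank y yC≈0 = W-rank y (≈ᵥ-trans (≈ᵥ-sym (yCV≈yW y)) (≈ᵥ-trans (·ᵥ-congˡ V yC≈0) (·ᵥ-zeroˡ V)))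
    y : Vec m
    y = proj₁ (fullRowRank⇒surjective C-rank x)
    yC≈x : y ·ᵥ C ≈ᵥ x
    yC≈x = proj₂ (fullRowRank⇒surjective C-rank x)

  nonzero-left-kernel : ∀ {m n} → n < m → (B : Mat m n) → ∃ λ x → ¬ x ≈ᵥ zeroᵥ × x ·ᵥ B ≈ᵥ zeroᵥ
  nonzero-left-kernel {m} n<m B
    with i , j , i<j , iB≈jB ← pigeonhole (ℕ.^-monoʳ-< q 1<q n<m) (λ i → vector {m} i ·ᵥ B)
    = vector i -ᵥ vector j
    , (λ i-j≈0 → Fin.<⇒≢ i<j (vector-injective (-ᵥ≈0⇒≈ _ _ i-j≈0)))
    , ≈ᵥ-trans (·ᵥ-distrib--ᵥ _ _ B) (≈⇒-ᵥ≈0 iB≈jB)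

  rowsp-overlap : ∀ {m m′ n} → n < m ℕ.+ m′ → (A : Mat m n) (B : Mat m′ n) →
                  ∃₂ λ a b → ¬ (a ≈ᵥ zeroᵥ × b ≈ᵥ zeroᵥ) × a ·ᵥ A ≈ᵥ b ·ᵥ B
  rowsp-overlap {m} n<m+m′ A B
    with x , x≉0 , x[A++B]≈0 ← nonzero-left-kernel n<m+m′ (A ++ B)
    = take m x , -ᵥ drop m x , not-both-zero
    , ≈ᵥ-trans (+ᵥ≈0⇒≈-ᵥ _ _ (≈ᵥ-trans (≈ᵥ-sym (·ᵥ-stack x A B)) x[A++B]≈0)) (≈ᵥ-sym (·ᵥ-neg (drop m x) B))
    where
    not-both-zero : ¬ (take m x ≈ᵥ zeroᵥ × -ᵥ drop m x ≈ᵥ zeroᵥ)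
    not-both-zero (x₁≈0 , -x₂≈0) =
      x≉0 (≈ᵥ-trans (++-ext x₁≈0 (-ᵥ-injective (≈ᵥ-trans -x₂≈0 (≈ᵥ-sym -ᵥ0≈0)))) (≈ᵥ-sym (zeroᵥ-++ {m})))

  fullRowRank⇒periodic : ∀ {n} {A : Mat n n} → FullRowRank A → ∀ x → ∃ λ d → x ≈ᵥ x ·ᵥ A ^ₘ suc d
  fullRowRank⇒periodic {n} {A} A-rank x
    with i , j , i<j , xAⁱ≈xAʲ ← pigeonhole (ℕ.n<1+n (q ^ n)) (λ i → x ·ᵥ A ^ₘ toℕ i)
    = d , fullRowRank-cancel (fullRowRank-^ₘ A-rank (toℕ i)) (begin
      x ·ᵥ A ^ₘ toℕ i                   ≈⟨ xAⁱ≈xAʲ ⟩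
      x ·ᵥ A ^ₘ toℕ j                   ≡⟨ ≡.cong (λ e → x ·ᵥ A ^ₘ e) j≡1+d+i ⟨
      x ·ᵥ A ^ₘ (suc d ℕ.+ toℕ i)       ≈⟨ ·ᵥ-^ₘ-+ x A (suc d) (toℕ i) ⟩
      x ·ᵥ A ^ₘ toℕ i ·ᵥ A ^ₘ suc d     ≈⟨ ·ᵥ-^ₘ-comm x A (toℕ i) (suc d) ⟩
      x ·ᵥ A ^ₘ suc d ·ᵥ A ^ₘ toℕ i     ∎)
    where
    open ≈ᵥ-Reasoning
    d : ℕ
    d = toℕ j ∸ suc (toℕ i)
    j≡1+d+i : suc d ℕ.+ toℕ i ≡ toℕ j
    j≡1+d+i = ≡.trans (≡.sym (ℕ.+-suc d (toℕ i))) (ℕ.m∸n+n≡m i<j)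

module Companion {c ℓ : Level} (F : FiniteField c ℓ) {k : ℕ} (f : LinAlg.MonicPoly F k) where
  open FiniteField F hiding (zero)
  open Matrices F
  open import Algebra.Properties.Ring ring using (-‿distribʳ-*)

  M : Mat (suc k) (suc k)
  M = companion f

  companion-inject₁ : ∀ (i : Fin k) j → M (Fin.inject₁ i) j ≡ δ (suc i) j
  companion-inject₁ i j with toℕ (Fin.inject₁ i) ℕ.<? k
  ... | no  i≮k = ⊥-elim (i≮k (≡.subst (_< k) (≡.sym (Fin.toℕ-inject₁ i)) (Fin.toℕ<n i)))
  ... | yes _   = ≡.cong (if_then 1# else 0#)
    (≡.trans (⌊≟⌋-sym (toℕ j) _) (≡.cong (λ t → ⌊ suc t ℕ.≟ toℕ j ⌋) (Fin.toℕ-inject₁ i)))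

  companion-last : ∀ j → M (Fin.fromℕ k) j ≡ - f j
  companion-last j with toℕ (Fin.fromℕ k) ℕ.<? k
  ... | no  _   = ≡.refl
  ... | yes k<k = ⊥-elim (ℕ.n≮n k (≡.subst (_< k) (Fin.toℕ-fromℕ k) k<k))

  -- Right multiplication by M is multiplication by x modulo f: the step of xPowMod.
  ·ᵥ-companion : ∀ w → w ·ᵥ M ≈ᵥ λ j → shiftX w j - w (Fin.fromℕ k) * f j
  ·ᵥ-companion w j = begin
    sumF (suc k) (λ i → w i * M i j)
      ≈⟨ sumF-init-last k (λ i → w i * M i j) ⟩
    sumF k (λ i → w (Fin.inject₁ i) * M (Fin.inject₁ i) j) + w (Fin.fromℕ k) * M (Fin.fromℕ k) j
      ≈⟨ +-cong (sumF-cong k (λ i → *-congˡ (reflexive (companion-inject₁ i j))))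
                (*-congˡ (reflexive (companion-last j))) ⟩
    sumF k (λ i → w (Fin.inject₁ i) * δ (suc i) j) + w (Fin.fromℕ k) * - f j
      ≈⟨ +-cong (shifted j) (sym (-‿distribʳ-* _ _)) ⟩
    shiftX w j - w (Fin.fromℕ k) * f j ∎
    where
    open ≈-Reasoning
    shifted : ∀ j → sumF k (λ i → w (Fin.inject₁ i) * δ (suc i) j) ≈ shiftX w j
    shifted zero    = sumF-zero k (λ _ → zeroʳ _)
    shifted (suc j) = trans (sumF-cong k (λ i → *-congˡ (reflexive (δ-suc i j))))
                            (sumF-δʳ k (w ∘ Fin.inject₁) j)

  e₀·companion^≈xPowMod : ∀ e → δ zero ·ᵥ M ^ₘ e ≈ᵥ xPowMod f e
  e₀·companion^≈xPowMod zero    = ·ᵥ-identity (δ zero)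
  e₀·companion^≈xPowMod (suc e) = ≈ᵥ-trans (·ᵥ-assoc (δ zero) (M ^ₘ e) M)
    (≈ᵥ-trans (·ᵥ-congˡ M (e₀·companion^≈xPowMod e)) (·ᵥ-companion (xPowMod f e)))

  -- δ i is basis (toℕ i) by definition; indexing by ℕ makes the induction below structural.
  basis : ℕ → Vec (suc k)
  basis m j = if ⌊ m ℕ.≟ toℕ j ⌋ then 1# else 0#

  e₀·companion^≈basis : ∀ m → m ≤ k → δ zero ·ᵥ M ^ₘ m ≈ᵥ basis m
  e₀·companion^≈basis zero    _   = ·ᵥ-identity (δ zero)
  e₀·companion^≈basis (suc m) m<k = begin
    δ zero ·ᵥ M ^ₘ suc m        ≈⟨ ·ᵥ-assoc (δ zero) (M ^ₘ m) M ⟩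
    δ zero ·ᵥ M ^ₘ m ·ᵥ M       ≈⟨ ·ᵥ-congˡ M (e₀·companion^≈basis m (ℕ.<⇒≤ m<k)) ⟩
    basis m ·ᵥ M                ≡⟨ ≡.cong (λ t → basis t ·ᵥ M) (≡.trans (Fin.toℕ-inject₁ i) (Fin.toℕ-fromℕ< m<k)) ⟨
    δ (Fin.inject₁ i) ·ᵥ M      ≈⟨ δ-·ᵥ (Fin.inject₁ i) M ⟩
    M (Fin.inject₁ i)           ≈⟨ reflexive ∘ companion-inject₁ i ⟩
    δ (suc i)                   ≡⟨ ≡.cong (basis ∘ suc) (Fin.toℕ-fromℕ< m<k) ⟩
    basis (suc m)               ∎
    where
    open ≈ᵥ-Reasoning
    i : Fin k
    i = Fin.fromℕ< m<k

  companion^-period : ∀ {N} → DividesXPowMinus1 f N → ∀ x → x ·ᵥ M ^ₘ N ≈ᵥ x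
  companion^-period {N} divides x =
    ≈ᵥ-trans (·ᵥ-congʳ x row-of-Mᴺ) (·ᵥ-identity x)
    where
    e₀·M^toℕ : ∀ i → δ zero ·ᵥ M ^ₘ toℕ i ≈ᵥ δ i
    e₀·M^toℕ i = e₀·companion^≈basis (toℕ i) (ℕ.s≤s⁻¹ (Fin.toℕ<n i))
    row-of-Mᴺ : ∀ i → (M ^ₘ N) i ≈ᵥ δ i
    row-of-Mᴺ i = begin
      (M ^ₘ N) i                            ≈⟨ δ-·ᵥ i (M ^ₘ N) ⟨
      δ i ·ᵥ M ^ₘ N                         ≈⟨ ·ᵥ-congˡ (M ^ₘ N) (e₀·M^toℕ i) ⟨
      δ zero ·ᵥ M ^ₘ toℕ i ·ᵥ M ^ₘ N        ≈⟨ ·ᵥ-^ₘ-comm (δ zero) M (toℕ i) N ⟩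
      δ zero ·ᵥ M ^ₘ N ·ᵥ M ^ₘ toℕ i        ≈⟨ ·ᵥ-congˡ (M ^ₘ toℕ i) (≈ᵥ-trans (e₀·companion^≈xPowMod N) divides) ⟩
      δ zero ·ᵥ M ^ₘ toℕ i                  ≈⟨ e₀·M^toℕ i ⟩
      δ i                                   ∎
      where open ≈ᵥ-Reasoning

module PrimitiveAction {c ℓ : Level} (F : FiniteField c ℓ) {k : ℕ} (f : LinAlg.MonicPoly F k)
                       (f-primitive : LinAlg.Primitive F f) where
  open FiniteField F hiding (zero; inverse)
  open Matrices F
  open FiniteLinearAlgebra F
  open Companion F f

  N : ℕ
  N = q ^ suc k ∸ 1

  1≤N : 1 ≤ N
  1≤N = proj₁ (proj₂ f-primitive)

  f∣xᴺ-1 : DividesXPowMinus1 f N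
  f∣xᴺ-1 = proj₁ (proj₂ (proj₂ f-primitive))

  N-minimal : ∀ e → 1 ≤ e → e < N → ¬ DividesXPowMinus1 f e
  N-minimal = proj₂ (proj₂ (proj₂ f-primitive))

  instance
    N-nonZero : ℕ.NonZero N
    N-nonZero = ℕ.>-nonZero 1≤N

  0%N≡0 : 0 % N ≡ 0
  0%N≡0 = m<n⇒m%n≡m {n = N} 1≤N

  q^[1+k]≡1+N : q ^ suc k ≡ suc N
  q^[1+k]≡1+N = m≡1+[m∸1] (q ^ suc k) 1≤N
    where
    m≡1+[m∸1] : ∀ m → 1 ≤ m ∸ 1 → m ≡ suc (m ∸ 1)
    m≡1+[m∸1] (suc m) _ = ≡.refl

  infixl 7 _⋆_
  _⋆_ : Vec (suc k) → ℕ → Vec (suc k)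
  z ⋆ e = z ·ᵥ M ^ₘ e

  e₀ : Vec (suc k)
  e₀ = δ zero

  ⋆-multiple : ∀ z t → z ⋆ (t ℕ.* N) ≈ᵥ z
  ⋆-multiple z zero    = ·ᵥ-identity z
  ⋆-multiple z (suc t) = ≈ᵥ-trans (·ᵥ-^ₘ-+ z M N (t ℕ.* N))
    (≈ᵥ-trans (companion^-period {N} f∣xᴺ-1 _) (⋆-multiple z t))

  ⋆-mod : ∀ z e → z ⋆ e ≈ᵥ z ⋆ (e % N)
  ⋆-mod z e = begin
    z ⋆ e                            ≡⟨ ≡.cong (z ⋆_) (m≡m%n+[m/n]*n e N) ⟩
    z ⋆ (e % N ℕ.+ e / N ℕ.* N)      ≈⟨ ·ᵥ-^ₘ-+ z M (e % N) (e / N ℕ.* N) ⟩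
    z ⋆ (e / N ℕ.* N) ⋆ (e % N)      ≈⟨ ·ᵥ-congˡ (M ^ₘ (e % N)) (⋆-multiple z (e / N)) ⟩
    z ⋆ (e % N)                      ∎
    where open ≈ᵥ-Reasoning

  inverse : ℕ → ℕ
  inverse e = (N ∸ 1) ℕ.* e

  ⋆-inverse : ∀ z e → z ⋆ e ⋆ inverse e ≈ᵥ z
  ⋆-inverse z e = begin
    z ⋆ e ⋆ inverse e          ≈⟨ ·ᵥ-^ₘ-+ z M (inverse e) e ⟨
    z ⋆ (inverse e ℕ.+ e)      ≡⟨ ≡.cong (z ⋆_) inverse-+ ⟩
    z ⋆ (e ℕ.* N)              ≈⟨ ⋆-multiple z e ⟩
    z                          ∎
    where
    open ≈ᵥ-Reasoning
    inverse-+ : inverse e ℕ.+ e ≡ e ℕ.* N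
    inverse-+ = ≡.trans (ℕ.+-comm (inverse e) e)
                        (≡.trans (≡.cong (ℕ._* e) (ℕ.suc-pred N)) (ℕ.*-comm N e))

  ⋆-injective : ∀ {z z′} e → z ⋆ e ≈ᵥ z′ ⋆ e → z ≈ᵥ z′
  ⋆-injective {z} {z′} e eq = ≈ᵥ-trans (≈ᵥ-sym (⋆-inverse z e))
    (≈ᵥ-trans (·ᵥ-congˡ (M ^ₘ inverse e) eq) (⋆-inverse z′ e))

  ⋆-zero : ∀ {z} e → z ⋆ e ≈ᵥ zeroᵥ → z ≈ᵥ zeroᵥ
  ⋆-zero e z⋆e≈0 = ⋆-injective e (≈ᵥ-trans z⋆e≈0 (≈ᵥ-sym (·ᵥ-zeroˡ (M ^ₘ e))))

  e₀⋆-nonzero : ∀ j → ¬ e₀ ⋆ j ≈ᵥ zeroᵥ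
  e₀⋆-nonzero j = δ-nonzero zero ∘ ⋆-zero j

  e₀⋆-period : ∀ d → e₀ ⋆ d ≈ᵥ e₀ → d % N ≡ 0
  e₀⋆-period d e₀⋆d≈e₀ with d % N in d%N≡r
  ... | zero  = ≡.refl
  ... | suc r = ⊥-elim (N-minimal (suc r) (ℕ.s≤s ℕ.z≤n) r<N (begin
    xPowMod f (suc r)     ≈⟨ e₀·companion^≈xPowMod (suc r) ⟨
    e₀ ⋆ suc r            ≡⟨ ≡.cong (e₀ ⋆_) d%N≡r ⟨
    e₀ ⋆ (d % N)          ≈⟨ ⋆-mod e₀ d ⟨
    e₀ ⋆ d                ≈⟨ e₀⋆d≈e₀ ⟩
    e₀                    ∎))
    where
    open ≈ᵥ-Reasoning
    r<N : suc r < N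
    r<N = ≡.subst (_< N) d%N≡r (m%n<n d N)

  %-absorbs-multiple : ∀ i d → d % N ≡ 0 → (i ℕ.+ d) % N ≡ i % N
  %-absorbs-multiple i d d%N≡0 = ≡.trans (≡.cong (λ t → (i ℕ.+ t) % N) d≡[d/N]*N) ([m+kn]%n≡m%n i (d / N) N)
    where
    d≡[d/N]*N : d ≡ d / N ℕ.* N
    d≡[d/N]*N = ≡.trans (m≡m%n+[m/n]*n d N) (≡.cong (ℕ._+ d / N ℕ.* N) d%N≡0)

  e₀⋆-injective-≤ : ∀ {i j} → i ≤ j → e₀ ⋆ i ≈ᵥ e₀ ⋆ j → i % N ≡ j % N
  e₀⋆-injective-≤ {i} {j} i≤j e₀⋆i≈e₀⋆j = ≡.sym (≡.trans
    (≡.cong (_% N) (≡.sym (ℕ.m+[n∸m]≡n i≤j)))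
    (%-absorbs-multiple i (j ∸ i) (e₀⋆-period (j ∸ i) (≈ᵥ-sym e₀≈e₀⋆[j∸i]))))
    where
    e₀≈e₀⋆[j∸i] : e₀ ≈ᵥ e₀ ⋆ (j ∸ i)
    e₀≈e₀⋆[j∸i] = ⋆-injective i (begin
      e₀ ⋆ i                   ≈⟨ e₀⋆i≈e₀⋆j ⟩
      e₀ ⋆ j                   ≡⟨ ≡.cong (e₀ ⋆_) (ℕ.m∸n+n≡m i≤j) ⟨
      e₀ ⋆ ((j ∸ i) ℕ.+ i)     ≈⟨ ·ᵥ-^ₘ-+ e₀ M (j ∸ i) i ⟩
      e₀ ⋆ i ⋆ (j ∸ i)         ≈⟨ ·ᵥ-^ₘ-comm e₀ M i (j ∸ i) ⟩
      e₀ ⋆ (j ∸ i) ⋆ i         ∎)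
      where open ≈ᵥ-Reasoning

  e₀⋆-injective : ∀ {i j} → e₀ ⋆ i ≈ᵥ e₀ ⋆ j → i % N ≡ j % N
  e₀⋆-injective {i} {j} eq with ℕ.≤-total i j
  ... | inj₁ i≤j = e₀⋆-injective-≤ i≤j eq
  ... | inj₂ j≤i = ≡.sym (e₀⋆-injective-≤ j≤i (≈ᵥ-sym eq))

  -- 0, e₀, e₀ ⋆ 1, …, e₀ ⋆ (N ∸ 1) are q ^ suc k distinct vectors, hence all of them.
  orbit-or-zero : ℕ → Vec (suc k)
  orbit-or-zero zero    = zeroᵥ
  orbit-or-zero (suc j) = e₀ ⋆ j

  orbit-or-zero-injective : ∀ {i j} → i ≤ N → j ≤ N → orbit-or-zero i ≈ᵥ orbit-or-zero j → i ≡ j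
  orbit-or-zero-injective {zero}  {zero}  _   _   _  = ≡.refl
  orbit-or-zero-injective {zero}  {suc j} _   _   eq = ⊥-elim (e₀⋆-nonzero j (≈ᵥ-sym eq))
  orbit-or-zero-injective {suc i} {zero}  _   _   eq = ⊥-elim (e₀⋆-nonzero i eq)
  orbit-or-zero-injective {suc i} {suc j} i<N j<N eq =
    ≡.cong suc (≡.trans (≡.sym (m<n⇒m%n≡m i<N)) (≡.trans (e₀⋆-injective eq) (m<n⇒m%n≡m j<N)))

  e₀⋆-surjective : ∀ {w} → ¬ w ≈ᵥ zeroᵥ → ∃ λ j → e₀ ⋆ j ≈ᵥ w
  e₀⋆-surjective {w} w≉0 = from-orbit-or-zero (injective⇒surjective (orbit-or-zero ∘ toℕ) injective w)
    where
    below : ∀ (i : Fin (q ^ suc k)) → toℕ i ≤ N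
    below i = ℕ.s≤s⁻¹ (≡.subst (toℕ i <_) q^[1+k]≡1+N (Fin.toℕ<n i))
    injective : ∀ {i j} → orbit-or-zero (toℕ i) ≈ᵥ orbit-or-zero (toℕ j) → i ≡ j
    injective {i} {j} eq = Fin.toℕ-injective (orbit-or-zero-injective (below i) (below j) eq)
    from-orbit-or-zero : (∃ λ (i : Fin (q ^ suc k)) → orbit-or-zero (toℕ i) ≈ᵥ w) → ∃ λ j → e₀ ⋆ j ≈ᵥ w
    from-orbit-or-zero (i , eq) with toℕ i
    ... | zero  = ⊥-elim (w≉0 (≈ᵥ-sym eq))
    ... | suc j = j , eq

  ⋆-free : ∀ w {e e′} → w ⋆ e ≈ᵥ w ⋆ e′ → w ≈ᵥ zeroᵥ ⊎ e % N ≡ e′ % N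
  ⋆-free w {e} {e′} w⋆e≈w⋆e′ with ≈ᵥ0? w
  ... | yes w≈0 = inj₁ w≈0
  ... | no  w≉0 with j , e₀⋆j≈w ← e₀⋆-surjective w≉0 = inj₂ (e₀⋆-injective (⋆-injective j (begin
    e₀ ⋆ e ⋆ j     ≈⟨ ·ᵥ-^ₘ-comm e₀ M e j ⟩
    e₀ ⋆ j ⋆ e     ≈⟨ ·ᵥ-congˡ (M ^ₘ e) e₀⋆j≈w ⟩
    w ⋆ e          ≈⟨ w⋆e≈w⋆e′ ⟩
    w ⋆ e′         ≈⟨ ·ᵥ-congˡ (M ^ₘ e′) e₀⋆j≈w ⟨
    e₀ ⋆ j ⋆ e′    ≈⟨ ·ᵥ-^ₘ-comm e₀ M j e′ ⟩
    e₀ ⋆ e′ ⋆ j    ∎)))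
    where open ≈ᵥ-Reasoning

  ⋆-transitive : ∀ {w w′} → ¬ w ≈ᵥ zeroᵥ → ¬ w′ ≈ᵥ zeroᵥ → ∃ λ e → w ⋆ e ≈ᵥ w′
  ⋆-transitive {w} {w′} w≉0 w′≉0
    with j , e₀⋆j≈w ← e₀⋆-surjective w≉0 | j′ , e₀⋆j′≈w′ ← e₀⋆-surjective w′≉0
    = j′ ℕ.+ inverse j , (begin
      w ⋆ (j′ ℕ.+ inverse j)     ≈⟨ ·ᵥ-^ₘ-+ w M j′ (inverse j) ⟩
      w ⋆ inverse j ⋆ j′         ≈⟨ ·ᵥ-congˡ (M ^ₘ j′) (·ᵥ-congˡ (M ^ₘ inverse j) e₀⋆j≈w) ⟨
      e₀ ⋆ j ⋆ inverse j ⋆ j′    ≈⟨ ·ᵥ-congˡ (M ^ₘ j′) (⋆-inverse e₀ j) ⟩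
      e₀ ⋆ j′                    ≈⟨ e₀⋆j′≈w′ ⟩
      w′                         ∎)
    where open ≈ᵥ-Reasoning

module OrbitCode {c ℓ : Level} (F : FiniteField c ℓ) {k : ℕ} (1<k : 1 < k)
                 (f : LinAlg.MonicPoly F k) (f-primitive : LinAlg.Primitive F f)
                 (U₁ : LinAlg.Mat F k k) (U₂ : LinAlg.Mat F k (suc k))
                 (U-rank : LinAlg.FullRowRank F (LinAlg._∣∣_ F U₁ U₂)) where
  open FiniteField F hiding (zero; inverse)
  open Matrices F
  open FiniteLinearAlgebra F
  open Companion F f using (M)
  open PrimitiveAction F f f-primitive

  U : Mat k (k ℕ.+ suc k)
  U = U₁ ∣∣ U₂

  g : Mat (k ℕ.+ suc k) (k ℕ.+ suc k)
  g = gen k f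

  W : ℕ → Mat k (k ℕ.+ suc k)
  W e = U ·ₘ g ^ₘ e

  W-inOrbit : ∀ e → InOrbit g U (W e)
  W-inOrbit e = e , ≃ₛ-refl

  row-W : ∀ y e → y ·ᵥ W e ≈ᵥ y ·ᵥ U₁ ++ y ·ᵥ U₂ ⋆ e
  row-W y e = begin
    y ·ᵥ (U ·ₘ g ^ₘ e)               ≈⟨ ·ᵥ-assoc y U (g ^ₘ e) ⟩
    y ·ᵥ U ·ᵥ g ^ₘ e                 ≈⟨ ·ᵥ-congˡ (g ^ₘ e) (·ᵥ-∣∣ y U₁ U₂) ⟩
    (y ·ᵥ U₁ ++ y ·ᵥ U₂) ·ᵥ g ^ₘ e   ≈⟨ ++-·ᵥ-blockDiag-identity-^ₘ (y ·ᵥ U₁) (y ·ᵥ U₂) M e ⟩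
    y ·ᵥ U₁ ++ y ·ᵥ U₂ ⋆ e           ∎
    where open ≈ᵥ-Reasoning

  rank-U : ∀ {y} → y ·ᵥ U₁ ≈ᵥ zeroᵥ → y ·ᵥ U₂ ≈ᵥ zeroᵥ → y ≈ᵥ zeroᵥ
  rank-U {y} yU₁≈0 yU₂≈0 =
    U-rank y (≈ᵥ-trans (·ᵥ-∣∣ y U₁ U₂) (≈ᵥ-trans (++-cong {k} yU₁≈0 yU₂≈0) (≈ᵥ-sym (zeroᵥ-++ {k}))))

  W-mod : ∀ {e e′} → e % N ≡ e′ % N → W e ≃ₛ W e′
  W-mod {e} {e′} e≡e′ = rowsp-≃ λ y → begin
    y ·ᵥ W e                       ≈⟨ row-W y e ⟩
    y ·ᵥ U₁ ++ y ·ᵥ U₂ ⋆ e         ≈⟨ ++-cong {k} ≈ᵥ-refl (⋆-mod (y ·ᵥ U₂) e) ⟩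
    y ·ᵥ U₁ ++ y ·ᵥ U₂ ⋆ (e % N)   ≡⟨ ≡.cong (λ d → y ·ᵥ U₁ ++ y ·ᵥ U₂ ⋆ d) e≡e′ ⟩
    y ·ᵥ U₁ ++ y ·ᵥ U₂ ⋆ (e′ % N)  ≈⟨ ++-cong {k} ≈ᵥ-refl (⋆-mod (y ·ᵥ U₂) e′) ⟨
    y ·ᵥ U₁ ++ y ·ᵥ U₂ ⋆ e′        ≈⟨ row-W y e′ ⟨
    y ·ᵥ W e′                      ∎
    where open ≈ᵥ-Reasoning

  infix 4 _⊕_∈U
  _⊕_∈U : Vec k → Vec (suc k) → Set (c ⊔ ℓ)
  a ⊕ z ∈U = ∃ λ y → y ·ᵥ U₁ ≈ᵥ a × y ·ᵥ U₂ ≈ᵥ z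

  ∈U-resp : ∀ {a a′ z z′} → a ≈ᵥ a′ → z ≈ᵥ z′ → a ⊕ z ∈U → a′ ⊕ z′ ∈U
  ∈U-resp a≈a′ z≈z′ (y , yU₁≈a , yU₂≈z) = y , ≈ᵥ-trans yU₁≈a a≈a′ , ≈ᵥ-trans yU₂≈z z≈z′

  ∈U-+ : ∀ {a a′ z z′} → a ⊕ z ∈U → a′ ⊕ z′ ∈U → a +ᵥ a′ ⊕ z +ᵥ z′ ∈U
  ∈U-+ (y , yU₁≈a , yU₂≈z) (y′ , y′U₁≈a′ , y′U₂≈z′) = y +ᵥ y′
    , ≈ᵥ-trans (·ᵥ-distrib-+ᵥ y y′ U₁) (+ᵥ-cong yU₁≈a y′U₁≈a′)
    , ≈ᵥ-trans (·ᵥ-distrib-+ᵥ y y′ U₂) (+ᵥ-cong yU₂≈z y′U₂≈z′)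

  ∈U-- : ∀ {a a′ z z′} → a ⊕ z ∈U → a′ ⊕ z′ ∈U → a -ᵥ a′ ⊕ z -ᵥ z′ ∈U
  ∈U-- (y , yU₁≈a , yU₂≈z) (y′ , y′U₁≈a′ , y′U₂≈z′) = y -ᵥ y′
    , ≈ᵥ-trans (·ᵥ-distrib--ᵥ y y′ U₁) (+ᵥ-cong yU₁≈a (-ᵥ-cong y′U₁≈a′))
    , ≈ᵥ-trans (·ᵥ-distrib--ᵥ y y′ U₂) (+ᵥ-cong yU₂≈z (-ᵥ-cong y′U₂≈z′))

  row∈U : ∀ i → U₁ i ⊕ U₂ i ∈U
  row∈U i = δ i , δ-·ᵥ i U₁ , δ-·ᵥ i U₂

  ∈U⇒∈W : ∀ {a z} → a ⊕ z ∈U → ∀ e → a ++ z ⋆ e ∈rowsp W e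
  ∈U⇒∈W (y , yU₁≈a , yU₂≈z) e =
    y , ≈ᵥ-sym (≈ᵥ-trans (row-W y e) (++-cong {k} yU₁≈a (·ᵥ-congˡ (M ^ₘ e) yU₂≈z)))

  ∈W₀⇒∈U : ∀ {a z} → a ++ z ∈rowsp W 0 → a ⊕ z ∈U
  ∈W₀⇒∈U (y , a++z≈yW₀) with a≈yU₁ , z≈yU₂ ← ++-injective {k} (≈ᵥ-trans a++z≈yW₀ (row-W y 0))
    = y , ≈ᵥ-sym a≈yU₁ , ≈ᵥ-sym (≈ᵥ-trans z≈yU₂ (·ᵥ-identity _))

  1<N : 1 < N
  1<N = ℕ.s≤s⁻¹ (begin-strict
    2           ≤⟨ 1<q ⟩
    q           ≡⟨ ℕ.*-identityʳ q ⟨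
    q ^ 1       <⟨ ℕ.^-monoʳ-< q 1<q (ℕ.s≤s (ℕ.<⇒≤ 1<k)) ⟩
    q ^ suc k   ≡⟨ q^[1+k]≡1+N ⟩
    suc N       ∎)
    where open ℕ.≤-Reasoning

  i₀ : Fin k
  i₀ = Fin.fromℕ< (ℕ.<-trans (ℕ.s≤s ℕ.z≤n) 1<k)

  1+k<k+k : suc k < k ℕ.+ k
  1+k<k+k = ≡.subst (_< k ℕ.+ k) (ℕ.+-comm k 1) (ℕ.+-monoʳ-< k 1<k)

  module FullRank (U₁-rank : FullRowRank U₁) (U₂-rank : FullRowRank U₂) where

    W-rank : ∀ e → FullRowRank (W e)
    W-rank e x xW≈0 =
      U₁-rank x (proj₁ (++-injective {k} (≈ᵥ-trans (≈ᵥ-sym (row-W x e)) (≈ᵥ-trans xW≈0 (zeroᵥ-++ {k})))))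

    shared-row : ∀ {y y′ e e′} → y ·ᵥ W e ≈ᵥ y′ ·ᵥ W e′ → y ≈ᵥ zeroᵥ ⊎ e % N ≡ e′ % N
    shared-row {y} {y′} {e} {e′} yWₑ≈y′Wₑ′
      with yU₁≈y′U₁ , yU₂⋆e≈y′U₂⋆e′ ← ++-injective {k} (≈ᵥ-trans (≈ᵥ-sym (row-W y e)) (≈ᵥ-trans yWₑ≈y′Wₑ′ (row-W y′ e′)))
      with ⋆-free (y ·ᵥ U₂) (≈ᵥ-trans yU₂⋆e≈y′U₂⋆e′
             (·ᵥ-congˡ (M ^ₘ e′) (·ᵥ-congˡ U₂ (≈ᵥ-sym (fullRowRank-cancel U₁-rank yU₁≈y′U₁)))))
    ... | inj₁ yU₂≈0 = inj₁ (U₂-rank y yU₂≈0)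
    ... | inj₂ e≡e′  = inj₂ e≡e′

    W-≃⇒mod : ∀ {e e′} → W e ≃ₛ W e′ → e % N ≡ e′ % N
    W-≃⇒mod {e} We≃We′ with y′ , row≈y′W ← Equivalence.to (We≃We′ (δ i₀ ·ᵥ W e)) (δ i₀ , ≈ᵥ-refl)
      with shared-row row≈y′W
    ... | inj₁ δ≈0  = ⊥-elim (δ-nonzero _ δ≈0)
    ... | inj₂ e≡e′ = e≡e′

    W-trivial : ∀ {e e′} → ¬ W e ≃ₛ W e′ → TrivialIntersection (W e) (W e′)
    W-trivial {e} {e′} We≄We′ v (y , v≈yW) (y′ , v≈y′W)
      with shared-row {y} {y′} {e} {e′} (≈ᵥ-trans (≈ᵥ-sym v≈yW) v≈y′W)
    ... | inj₁ y≈0  = ≈ᵥ-trans v≈yW (≈ᵥ-trans (·ᵥ-congˡ (W e) y≈0) (·ᵥ-zeroˡ (W e)))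
    ... | inj₂ e≡e′ = ⊥-elim (We≄We′ (W-mod {e} {e′} e≡e′))

    isPartialSpread : IsPartialSpread (InOrbit g U)
    isPartialSpread = members-rank , (W 0 , W 1 , W-inOrbit 0 , W-inOrbit 1 , W₀≄W₁) , members-trivial
      where
      members-rank : ∀ V → InOrbit g U V → FullRowRank V
      members-rank V (e , V≃We) = fullRowRank-resp-≃ {V = V} {W e} V≃We (W-rank e)
      W₀≄W₁ : ¬ W 0 ≃ₛ W 1
      W₀≄W₁ W₀≃W₁ =
        ℕ.0≢1+n (≡.trans (≡.sym 0%N≡0) (≡.trans (W-≃⇒mod {0} {1} W₀≃W₁) (m<n⇒m%n≡m {n = N} 1<N)))
      members-trivial : ∀ V V′ → InOrbit g U V → InOrbit g U V′ → ¬ V ≃ₛ V′ → TrivialIntersection V V′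
      members-trivial V V′ (e , V≃We) (e′ , V′≃We′) V≄V′ v v∈V v∈V′ =
        W-trivial {e} {e′} (λ We≃We′ → V≄V′ (≃ₛ-trans V≃We (≃ₛ-trans We≃We′ (≃ₛ-sym V′≃We′))))
                  v (Equivalence.to (V≃We v) v∈V) (Equivalence.to (V′≃We′ v) v∈V′)

    orbit-cardinality : HasCardinality (InOrbit g U) N
    orbit-cardinality = W ∘ toℕ , W-inOrbit ∘ toℕ , injective , surjective
      where
      injective : ∀ i j → W (toℕ i) ≃ₛ W (toℕ j) → i ≡ j
      injective i j Wᵢ≃Wⱼ = Fin.toℕ-injective (≡.trans (≡.sym (m<n⇒m%n≡m {n = N} (Fin.toℕ<n i)))
                                               (≡.trans (W-≃⇒mod {toℕ i} {toℕ j} Wᵢ≃Wⱼ) (m<n⇒m%n≡m {n = N} (Fin.toℕ<n j))))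
      surjective : ∀ V → InOrbit g U V → ∃ λ i → V ≃ₛ W (toℕ i)
      surjective V (e , V≃We) = Fin.fromℕ< (m%n<n e N) , ≃ₛ-trans V≃We (W-mod {e} (≡.sym (begin-equality
        toℕ (Fin.fromℕ< (m%n<n e N)) % N   ≡⟨ ≡.cong (_% N) (Fin.toℕ-fromℕ< (m%n<n e N)) ⟩
        e % N % N                          ≡⟨ m%n%n≡m%n e N ⟩
        e % N                              ∎)))
        where open ℕ.≤-Reasoning

  module Spread (spread : IsPartialSpread (InOrbit g U)) where

    distinct-members : ∃₂ λ e e′ → ¬ W e ≃ₛ W e′
    distinct-members with V , V′ , (e , V≃We) , (e′ , V′≃We′) , V≄V′ ← proj₁ (proj₂ spread)
      = e , e′ , λ We≃We′ → V≄V′ (≃ₛ-trans V≃We (≃ₛ-trans We≃We′ (≃ₛ-sym V′≃We′)))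

    W-trivial : ∀ {e e′} → ¬ W e ≃ₛ W e′ → TrivialIntersection (W e) (W e′)
    W-trivial {e} {e′} = proj₂ (proj₂ spread) (W e) (W e′) (W-inOrbit e) (W-inOrbit e′)

    in-every-W⇒zero : ∀ {v} → (∀ e → v ∈rowsp W e) → v ≈ᵥ zeroᵥ
    in-every-W⇒zero {v} v∈W with e , e′ , We≄We′ ← distinct-members
      = W-trivial {e} {e′} We≄We′ v (v∈W e) (v∈W e′)

    ∈U-zero-tail : ∀ {a} → a ⊕ zeroᵥ ∈U → a ≈ᵥ zeroᵥ
    ∈U-zero-tail {a} a⊕0∈U = proj₁ (++-injective {k} (≈ᵥ-trans a++0≈0 (zeroᵥ-++ {k})))
      where
      a++0≈0 : a ++ zeroᵥ ≈ᵥ zeroᵥ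
      a++0≈0 = in-every-W⇒zero λ e →
        ∈rowsp-resp {V = W e} (++-cong {k} ≈ᵥ-refl (·ᵥ-zeroˡ (M ^ₘ e))) (∈U⇒∈W a⊕0∈U e)

    U₂-rank : FullRowRank U₂
    U₂-rank x xU₂≈0 = rank-U (∈U-zero-tail (x , ≈ᵥ-refl , xU₂≈0)) xU₂≈0

    -- Otherwise two distinct members of dimension k lie in zeroᵥ ++ F^(k+1), and 2k > k + 1.
    U₁-nonzero : ¬ (∀ i → U₁ i ≈ᵥ zeroᵥ)
    U₁-nonzero U₁≈0 with e , e′ , We≄We′ ← distinct-members
      with a , b , not-both-zero , aU₂Mᵉ≈bU₂Mᵉ′ ← rowsp-overlap 1+k<k+k (U₂ ·ₘ M ^ₘ e) (U₂ ·ₘ M ^ₘ e′)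
      = not-both-zero (zero-tail e aU₂⋆e≈0 , zero-tail e′ (≈ᵥ-trans (≈ᵥ-sym aU₂⋆e≈bU₂⋆e′) aU₂⋆e≈0))
      where
      zero-tail : ∀ {y} e → y ·ᵥ U₂ ⋆ e ≈ᵥ zeroᵥ → y ≈ᵥ zeroᵥ
      zero-tail {y} e yU₂⋆e≈0 = rank-U (·ᵥ-zero-rows y U₁≈0) (⋆-zero e yU₂⋆e≈0)
      aU₂⋆e≈bU₂⋆e′ : a ·ᵥ U₂ ⋆ e ≈ᵥ b ·ᵥ U₂ ⋆ e′
      aU₂⋆e≈bU₂⋆e′ = ≈ᵥ-trans (≈ᵥ-sym (·ᵥ-assoc a U₂ (M ^ₘ e))) (≈ᵥ-trans aU₂Mᵉ≈bU₂Mᵉ′ (·ᵥ-assoc b U₂ (M ^ₘ e′)))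
      v∈Wₑ : zeroᵥ ++ a ·ᵥ U₂ ⋆ e ∈rowsp W e
      v∈Wₑ = ∈U⇒∈W (a , ·ᵥ-zero-rows a U₁≈0 , ≈ᵥ-refl) e
      v∈Wₑ′ : zeroᵥ ++ a ·ᵥ U₂ ⋆ e ∈rowsp W e′
      v∈Wₑ′ = ∈rowsp-resp {V = W e′} (++-cong {k} ≈ᵥ-refl (≈ᵥ-sym aU₂⋆e≈bU₂⋆e′))
                (∈U⇒∈W (b , ·ᵥ-zero-rows b U₁≈0 , ≈ᵥ-refl) e′)
      aU₂⋆e≈0 : a ·ᵥ U₂ ⋆ e ≈ᵥ zeroᵥ
      aU₂⋆e≈0 = proj₂ (++-injective {k} (≈ᵥ-trans (W-trivial {e} {e′} We≄We′ _ v∈Wₑ v∈Wₑ′) (zeroᵥ-++ {k})))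

    module NonzeroRow {x : Vec k} (xU₁≈0 : x ·ᵥ U₁ ≈ᵥ zeroᵥ) (b≉0 : ¬ x ·ᵥ U₂ ≈ᵥ zeroᵥ)
                      {i : Fin k} (u≉0 : ¬ U₁ i ≈ᵥ zeroᵥ) where
      u : Vec k
      u = U₁ i

      c₀ b : Vec (suc k)
      c₀ = U₂ i
      b  = x ·ᵥ U₂

      nonzero-tail : ∀ {z} → u ⊕ z ∈U → ¬ z ≈ᵥ zeroᵥ
      nonzero-tail u⊕z z≈0 = u≉0 (∈U-zero-tail (∈U-resp ≈ᵥ-refl z≈0 u⊕z))

      u⊕c₀+b : u ⊕ c₀ +ᵥ b ∈U
      u⊕c₀+b = ∈U-resp (+ᵥ-identityʳ u) ≈ᵥ-refl (∈U-+ (row∈U i) (x , xU₁≈0 , ≈ᵥ-refl))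

      c₀-to-c₀+b : ∃ λ e → c₀ ⋆ e ≈ᵥ c₀ +ᵥ b
      c₀-to-c₀+b = ⋆-transitive (nonzero-tail (row∈U i)) (nonzero-tail u⊕c₀+b)

      e : ℕ
      e = proj₁ c₀-to-c₀+b

      c₀⋆e≈c₀+b : c₀ ⋆ e ≈ᵥ c₀ +ᵥ b
      c₀⋆e≈c₀+b = proj₂ c₀-to-c₀+b

      e≢0 : ¬ e % N ≡ 0
      e≢0 e%N≡0 = b≉0 (+ᵥ-identityʳ-unique c₀ b (begin
        c₀ +ᵥ b        ≈⟨ c₀⋆e≈c₀+b ⟨
        c₀ ⋆ e         ≈⟨ ⋆-mod c₀ e ⟩
        c₀ ⋆ (e % N)   ≡⟨ ≡.cong (c₀ ⋆_) e%N≡0 ⟩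
        c₀ ⋆ 0         ≈⟨ ·ᵥ-identity c₀ ⟩
        c₀             ∎))
        where open ≈ᵥ-Reasoning

      -- W 0 ≃ₛ W e is not decidable, but the goal is ⊥, so its double negation suffices.
      W₀≃Wₑ-irrefutable : ¬ ¬ W 0 ≃ₛ W e
      W₀≃Wₑ-irrefutable W₀≄Wₑ =
        u≉0 (proj₁ (++-injective {k} (≈ᵥ-trans (W-trivial {0} {e} W₀≄Wₑ _ v∈W₀ v∈Wₑ) (zeroᵥ-++ {k}))))
        where
        v∈W₀ : u ++ c₀ +ᵥ b ∈rowsp W 0
        v∈W₀ = ∈rowsp-resp {V = W 0} (++-cong {k} ≈ᵥ-refl (·ᵥ-identity _)) (∈U⇒∈W u⊕c₀+b 0)
        v∈Wₑ : u ++ c₀ +ᵥ b ∈rowsp W e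
        v∈Wₑ = ∈rowsp-resp {V = W e} (++-cong {k} ≈ᵥ-refl c₀⋆e≈c₀+b) (∈U⇒∈W (row∈U i) e)

      -- If W 0 = W e, then W 0 is invariant under a ++ z ↦ a ++ z M^e. Hence its part
      -- K = {z ∣ zeroᵥ ⊕ z ∈U} is invariant under B = M^e − I, which is invertible since the
      -- action is free and e ≢ 0. K contains c₀ B, so by periodicity of B also c₀, and then
      -- u ++ 0 lies in W 0 and hence in every member.
      module Invariant (W₀≃Wₑ : W 0 ≃ₛ W e) where
        shift : ∀ {a z} → a ⊕ z ∈U → a ⊕ z ⋆ e ∈U
        shift a⊕z = ∈W₀⇒∈U (Equivalence.from (W₀≃Wₑ _) (∈U⇒∈W a⊕z e))

        B : Mat (suc k) (suc k)
        B = M ^ₘ e -ₘ identity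

        zB≈z⋆e-z : ∀ z → z ·ᵥ B ≈ᵥ z ⋆ e -ᵥ z
        zB≈z⋆e-z z = ≈ᵥ-trans (·ᵥ-distrib--ₘ z (M ^ₘ e) identity) (+ᵥ-cong ≈ᵥ-refl (-ᵥ-cong (·ᵥ-identity z)))

        B-rank : FullRowRank B
        B-rank z zB≈0 = [ id , (λ e≡0 → ⊥-elim (e≢0 (≡.trans e≡0 0%N≡0))) ]′ (⋆-free z {e} {0} z⋆e≈z⋆0)
          where
          z⋆e≈z⋆0 : z ⋆ e ≈ᵥ z ⋆ 0
          z⋆e≈z⋆0 = ≈ᵥ-trans (-ᵥ≈0⇒≈ (z ⋆ e) z (≈ᵥ-trans (≈ᵥ-sym (zB≈z⋆e-z z)) zB≈0)) (≈ᵥ-sym (·ᵥ-identity z))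

        kernel-closed : ∀ {z} → zeroᵥ ⊕ z ∈U → zeroᵥ ⊕ z ·ᵥ B ∈U
        kernel-closed {z} 0⊕z = ∈U-resp (-ᵥ-inverseʳ zeroᵥ) (≈ᵥ-sym (zB≈z⋆e-z z)) (∈U-- (shift 0⊕z) 0⊕z)

        kernel-closed-^ₘ : ∀ {z} d → zeroᵥ ⊕ z ∈U → zeroᵥ ⊕ z ·ᵥ B ^ₘ d ∈U
        kernel-closed-^ₘ     zero    0⊕z = ∈U-resp ≈ᵥ-refl (≈ᵥ-sym (·ᵥ-identity _)) 0⊕z
        kernel-closed-^ₘ {z} (suc d) 0⊕z =
          ∈U-resp ≈ᵥ-refl (≈ᵥ-sym (·ᵥ-assoc z (B ^ₘ d) B)) (kernel-closed (kernel-closed-^ₘ d 0⊕z))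

        0⊕c₀B : zeroᵥ ⊕ c₀ ·ᵥ B ∈U
        0⊕c₀B = ∈U-resp (-ᵥ-inverseʳ u) (≈ᵥ-sym (zB≈z⋆e-z c₀)) (∈U-- (shift (row∈U i)) (row∈U i))

        0⊕c₀ : zeroᵥ ⊕ c₀ ∈U
        0⊕c₀ = from-period (fullRowRank⇒periodic B-rank c₀)
          where
          from-period : (∃ λ d → c₀ ≈ᵥ c₀ ·ᵥ B ^ₘ suc d) → zeroᵥ ⊕ c₀ ∈U
          from-period (d , c₀≈c₀Bᵈ⁺¹) =
            ∈U-resp ≈ᵥ-refl (≈ᵥ-sym (≈ᵥ-trans c₀≈c₀Bᵈ⁺¹ (·ᵥ-^ₘ-suc c₀ B d))) (kernel-closed-^ₘ d 0⊕c₀B)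

        u⊕0 : u ⊕ zeroᵥ ∈U
        u⊕0 = ∈U-resp (≈ᵥ-trans (+ᵥ-cong ≈ᵥ-refl -ᵥ0≈0) (+ᵥ-identityʳ u)) (-ᵥ-inverseʳ c₀) (∈U-- (row∈U i) 0⊕c₀)

      W₀≄Wₑ : ¬ W 0 ≃ₛ W e
      W₀≄Wₑ W₀≃Wₑ = u≉0 (∈U-zero-tail (Invariant.u⊕0 W₀≃Wₑ))

      contradiction : ⊥
      contradiction = W₀≃Wₑ-irrefutable W₀≄Wₑ

    U₁-rank : FullRowRank U₁
    U₁-rank x xU₁≈0 with ≈ᵥ0? (x ·ᵥ U₂) | zero-or-nonzero-row U₁
    ... | yes xU₂≈0 | _              = rank-U xU₁≈0 xU₂≈0
    ... | no  _     | inj₁ U₁≈0      = ⊥-elim (U₁-nonzero U₁≈0)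
    ... | no  xU₂≉0 | inj₂ (_ , u≉0) = ⊥-elim (NonzeroRow.contradiction xU₁≈0 xU₂≉0 u≉0)

  ranks-of-spread : IsPartialSpread (InOrbit g U) → FullRowRank U₁ × FullRowRank U₂
  ranks-of-spread spread = Spread.U₁-rank spread , Spread.U₂-rank spread

  spread-of-ranks : FullRowRank U₁ × FullRowRank U₂ → IsPartialSpread (InOrbit g U)
  spread-of-ranks (U₁-rank , U₂-rank) = FullRank.isPartialSpread U₁-rank U₂-rank

  spread-cardinality : IsPartialSpread (InOrbit g U) → HasCardinality (InOrbit g U) N
  spread-cardinality spread = FullRank.orbit-cardinality (Spread.U₁-rank spread) (Spread.U₂-rank spread)

proposition5p5 : ∀ {c ℓ : Level} (F : FiniteField c ℓ) → let open LinAlg F in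
    ∀ (k : ℕ) → 1 < k → (f : MonicPoly k) → Primitive f →
    (U₁ : Mat k k) (U₂ : Mat k (suc k)) → FullRowRank (U₁ ∣∣ U₂) →
      (IsPartialSpread (InOrbit (gen k f) (U₁ ∣∣ U₂))
         ⇔ (FullRowRank U₁ × FullRowRank U₂))
    × (IsPartialSpread (InOrbit (gen k f) (U₁ ∣∣ U₂))
         → HasCardinality (InOrbit (gen k f) (U₁ ∣∣ U₂)) (q ^ suc k ∸ 1))
proposition5p5 F k 1<k f f-primitive U₁ U₂ U-rank =
  mk⇔ ranks-of-spread spread-of-ranks , spread-cardinality
  where open OrbitCode F 1<k f f-primitive U₁ U₂ U-rank
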